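{- A properly colored digraph $(G,\sigma)$ with vertex set $L$ is a binary-explainable qBMG if and only if $\mathscr{R}^{B}(G,\sigma)$ is consistent. In this case, for every refinement $T$ of the tree $\mathrm{BUILD}(\mathscr{R}^{B}(G,\sigma),L)$, there is a truncation map $u$ such that $(T,\sigma,u)$ explains $(G,\sigma)$.
   Context: Digraphs are finite and simple; $\sigma$ is proper if $\sigma(x)=\sigma(y)$ implies $xy,yx\notin E(G)$. All rooted trees are phylogenetic; $v\preceq_T u$ means $u$ is on the path from root $\rho_T$ to $v$; $\mathrm{lca}_T$ is the least common ancestor. Best match: in a leaf-colored tree $(T,\sigma)$, leaf $y$ is a best match of leaf $x$ if $\sigma(x)\ne\sigma(y)$ and $\mathrm{lca}_T(x,y)\preceq_T\mathrm{lca}_T(x,y')$ for all leaves $y'$ with $\sigma(y')=\sigma(y)$. A truncation map $u\colon L(T)\times S\to V(T)$ (with $\sigma(L(T))\subseteq S$) sends $(x,s)$ to a vertex on the path from $\rho_T$ to $x$, with $u(x,\sigma(x))=x$; $y$ is a quasi-best match of $x$ if it is a best match and $\mathrm{lca}_T(x,y)\preceq_T u(x,\sigma(y))$. The qBMG of $(T,\sigma,u)$ is the vertex-colored digraph on $L(T)$ with arcs $xy$ for quasi-best matches $y$ of $x$, and $(T,\sigma,u)$ explains it. $(G,\sigma)$ is a binary-explainable qBMG if it is explained by some $(T,\sigma,u)$ with $T$ binary (every inner vertex has exactly two children). A tree displays a triple $ab|c$ if $a,b,c$ are distinct leaves and $\mathrm{lca}_T(a,b)\prec_T\mathrm{lca}_T(a,c)=\mathrm{lca}_T(b,c)$;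 a set of triples is consistent if some tree displays all of them. $\mathscr{R}(G,\sigma)=\{ab|b' : \sigma(a)\ne\sigma(b)=\sigma(b'),\ ab\in E(G),\ ab'\notin E(G)\}$, $\mathscr{F}(G,\sigma)=\{ab|b' : \sigma(a)\ne\sigma(b)=\sigma(b'),\ b\ne b',\ ab,ab'\in E(G)\}$, and $\mathscr{R}^{B}(G,\sigma)=\mathscr{R}(G,\sigma)\cup\{bb'|a : ab|b'\in\mathscr{F}(G,\sigma)\}$. For a triple set $\mathscr{R}$ and $L'\subseteq L$, $\mathscr{R}_{L'}$ is the set of triples of $\mathscr{R}$ with all three leaves in $L'$, and the Aho graph $[\mathscr{R},L']$ is the undirected graph on $L'$ with edges $xy$ whenever $xy|z\in\mathscr{R}$ for some $z$. $\mathrm{BUILD}(\mathscr{R},L)$ is the tree returned by the recursive algorithm: for $|L|=1$ return the single vertex; otherwise, if $[\mathscr{R}_L,L]$ is connected it fails, else it recursively computes $\mathrm{BUILD}(\mathscr{R}_C,C)$ for each connected component $C$ and returns the tree with a new root whose children are the roots of these subtrees. A refinement of a tree $T'$ is a tree $T$ with the same leaf set such that $T'$ is obtained from $T$ by a (possibly empty) sequence of contractions of inner edges. -}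

module Defs where

open import Data.Nat using (ℕ; zero; suc; _≤_; _≟_)
open import Data.Fin using (Fin) renaming (_≟_ to _≟ᶠ_)
open import Data.Fin.Subset using (Subset; ∣_∣; ⋃; Nonempty; Empty; _∩_) renaming (_∈_ to _∈ₛ_)
open import Data.List using (List; []; _∷_; _++_; length)
open import Data.List.Membership.Propositional using (_∈_)
open import Data.List.Relation.Unary.All using (All)
open import Data.List.Relation.Unary.Unique.Propositional using (Unique)
open import Data.List.Relation.Unary.AllPairs using (AllPairs)
open import Data.List.Relation.Binary.Pointwise using (Pointwise)
open import Data.List.Relation.Binary.Permutation.Propositional using (_↭_)
open import Data.Maybe using (Maybe; just; nothing)
open import Data.Bool using (Bool; true; false)
open import Data.Product using (Σ; ∃; _×_; _,_)
open import Data.Sum using (_⊎_)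
open import Relation.Nullary using (¬_; yes; no)
open import Relation.Binary.PropositionalEquality using (_≡_; _≢_)
open import Relation.Binary.Construct.Closure.ReflexiveTransitive using (Star)
open import Function.Bundles using (_⇔_)

-- An inner vertex is a 'node' with its list of children.  (Child order
-- is irrelevant: refinement below is taken up to reordering children.)

data Tree (n : ℕ) : Set where
  leaf : Fin n → Tree n
  node : List (Tree n) → Tree n

-- Vertices of a tree are addressed by the list of child indices on the
-- path from the root (the root is []).
Vertex : Set
Vertex = List ℕ

-- v ⪯ u  ("u lies on the path from the root to v"):  u is a prefix of v
_⪯_ : Vertex → Vertex → Set
v ⪯ u = Σ Vertex λ s → v ≡ u ++ s

_≺_ : Vertex → Vertex → Set
v ≺ u = v ⪯ u × v ≢ u

-- longest common prefix of two root paths = least common ancestor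
lcp : Vertex → Vertex → Vertex
lcp [] _ = []
lcp (_ ∷ _) [] = []
lcp (a ∷ p) (b ∷ q) with a ≟ b
... | yes _ = a ∷ lcp p q
... | no _  = []

module _ {n : ℕ} where

  leaves     : Tree n → List (Fin n)
  leavesList : List (Tree n) → List (Fin n)
  leaves (leaf x)  = x ∷ []
  leaves (node cs) = leavesList cs
  leavesList []       = []
  leavesList (c ∷ cs) = leaves c ++ leavesList cs

  data Phylo : Tree n → Set where
    leaf : ∀ x → Phylo (leaf x)
    node : ∀ {cs} → 2 ≤ length cs → All Phylo cs → Phylo (node cs)

  data Binary : Tree n → Set where
    leaf : ∀ x → Binary (leaf x)
    node : ∀ {l r} → Binary l → Binary r → Binary (node (l ∷ r ∷ []))

  PhyloOn : Tree n → Set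
  PhyloOn T = Phylo T × Unique (leaves T) × (∀ x → x ∈ leaves T)

  addrM     : Tree n → Fin n → Maybe Vertex
  addrMList : ℕ → List (Tree n) → Fin n → Maybe Vertex
  addrM (leaf y) x with x ≟ᶠ y
  ... | yes _ = just []
  ... | no _  = nothing
  addrM (node cs) x = addrMList 0 cs x
  addrMList i [] x = nothing
  addrMList i (c ∷ cs) x with addrM c x
  ... | just p  = just (i ∷ p)
  ... | nothing = addrMList (suc i) cs x

  -- the vertex of T that is the leaf x (only used for trees with
  -- leaf set Fin n, where every x occurs; the default is never used)
  addr : Tree n → Fin n → Vertex
  addr T x with addrM T x
  ... | just p  = p
  ... | nothing = []

  lca : Tree n → Fin n → Fin n → Vertex
  lca T x y = lcp (addr T x) (addr T y)

  Digraph : Set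
  Digraph = Fin n → Fin n → Bool

  Arc : Digraph → Fin n → Fin n → Set
  Arc G x y = G x y ≡ true

  module _ {k : ℕ} where

    BestMatch : Tree n → (Fin n → Fin k) → Fin n → Fin n → Set
    BestMatch T σ x y =
      σ x ≢ σ y × (∀ y′ → σ y′ ≡ σ y → lca T x y ⪯ lca T x y′)

    IsTruncation : Tree n → (Fin n → Fin k) → (Fin n → Fin k → Vertex) → Set
    IsTruncation T σ u =
      (∀ x s → addr T x ⪯ u x s) × (∀ x → u x (σ x) ≡ addr T x)

    QuasiBestMatch : Tree n → (Fin n → Fin k) → (Fin n → Fin k → Vertex)
                   → Fin n → Fin n → Set
    QuasiBestMatch T σ u x y = BestMatch T σ x y × lca T x y ⪯ u x (σ y)

    Explains : Tree n → (Fin n → Fin k) → (Fin n → Fin k → Vertex) → Digraph → Set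
    Explains T σ u G =
      PhyloOn T × IsTruncation T σ u
      × (∀ x y → Arc G x y ⇔ QuasiBestMatch T σ u x y)

    BinaryExplainableQBMG : Digraph → (Fin n → Fin k) → Set
    BinaryExplainableQBMG G σ =
      Σ (Tree n) λ T → Σ (Fin n → Fin k → Vertex) λ u → Binary T × Explains T σ u G

    ProperlyColored : Digraph → (Fin n → Fin k) → Set
    ProperlyColored G σ = ∀ x y → σ x ≡ σ y → ¬ Arc G x y × ¬ Arc G y x

  -- Triples.  A triple set is a predicate R with  R a b c  meaning
  -- ab|c ∈ R  (ab|c and ba|c denote the same triple; see Aho edges).

  Triples : Set₁
  Triples = Fin n → Fin n → Fin n → Set

  Displays : Tree n → Fin n → Fin n → Fin n → Set
  Displays T a b c =
    a ≢ b × a ≢ c × b ≢ c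
    × lca T a b ≺ lca T a c × lca T a c ≡ lca T b c

  Consistent : Triples → Set
  Consistent R = Σ (Tree n) λ T → PhyloOn T × (∀ a b c → R a b c → Displays T a b c)

  module _ {k : ℕ} (G : Digraph) (σ : Fin n → Fin k) where

    ℛ : Triples
    ℛ a b b′ = σ a ≢ σ b × σ b ≡ σ b′ × Arc G a b × ¬ Arc G a b′

    ℱ : Triples
    ℱ a b b′ = σ a ≢ σ b × σ b ≡ σ b′ × b ≢ b′ × Arc G a b × Arc G a b′

    -- ℛᴮ = ℛ ∪ { bb′|a : ab|b′ ∈ ℱ }
    ℛᴮ : Triples
    ℛᴮ x y z = ℛ x y z ⊎ ℱ z x y

  restrict : Triples → Subset n → Triples
  restrict R L′ a b c = R a b c × a ∈ₛ L′ × b ∈ₛ L′ × c ∈ₛ L′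

  -- edge xy of the Aho graph [R, L′] (for R = ℛ_{L′}, whose triples
  -- have all leaves in L′)
  AhoEdge : Triples → Subset n → Fin n → Fin n → Set
  AhoEdge R L′ x y = x ∈ₛ L′ × y ∈ₛ L′ × Σ (Fin n) λ z → R x y z ⊎ R y x z

  Components : Triples → Subset n → List (Subset n) → Set
  Components R L′ Cs =
    All Nonempty Cs
    × ⋃ Cs ≡ L′
    × AllPairs (λ C D → Empty (C ∩ D)
                        × (∀ x y → x ∈ₛ C → y ∈ₛ D → ¬ AhoEdge R L′ x y)) Cs
    × All (λ C → ∀ x y → x ∈ₛ C → y ∈ₛ C → Star (AhoEdge R L′) x y) Cs

  -- IsBuild R L′ T : T is (up to the order of children) the tree returned
  -- by BUILD(R, L′); no such T exists iff BUILD fails.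
  data IsBuild : Triples → Subset n → Tree n → Set₁ where
    single : ∀ {R L′ x} → ∣ L′ ∣ ≡ 1 → x ∈ₛ L′ → IsBuild R L′ (leaf x)
    split  : ∀ {R L′ Cs Ts}
           → Components (restrict R L′) L′ Cs
           → 2 ≤ length Cs
           → Pointwise (λ C T → IsBuild (restrict R C) C T) Cs Ts
           → IsBuild R L′ (node Ts)

  data Step : Tree n → Tree n → Set where
    contract : ∀ pre ds post
             → Step (node (pre ++ node ds ∷ post)) (node (pre ++ ds ++ post))
    reorder  : ∀ {cs ds} → cs ↭ ds → Step (node cs) (node ds)
    inside   : ∀ pre {c c′} post → Step c c′
             → Step (node (pre ++ c ∷ post)) (node (pre ++ c′ ∷ post))

  -- T is a refinement of T′: T′ is obtained from T by a (possibly empty)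
  -- sequence of contractions of inner edges (up to isomorphism)
  Refines : Tree n → Tree n → Set
  Refines T T′ = Star Step T T′

module Submission where

-- A binary tree explaining (G,σ) displays every triple ab|b′ of ℛ: the out-neighbour b of a is
-- strictly closer to a than the same-coloured non-neighbour b′, for otherwise b′ would be a
-- quasi-best match of a as well.  It displays every triple bb′|a coming from ℱ: b and b′ are both
-- best matches of a, so lca(a,b) = lca(a,b′), and as that vertex has only two children they lie
-- below the same one.  Conversely, any tree displaying ℛᴮ explains (G,σ) with the truncation
-- u(x,s) = lca(x,b) for an out-neighbour b of x of colour s (the ℱ-triples make this independent
-- of b), and u(x,s) = x if there is none.  Displayed triples are clusters, and clusters survive
-- refinement; so this applies to a binarization of any tree witnessing consistency, and to every
-- refinement of BUILD(ℛᴮ,L), whose clusters display ℛᴮ.  BUILD does not fail on a consistent set: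
-- in a tree displaying it, the lca P of the current leaf set separates the Aho graph, as a triple
-- ab|c over these leaves forces lca(a,b) strictly below P.

open import Defs
open import Data.Nat using (ℕ)
open import Data.Fin using (Fin)
open import Data.Fin.Subset using (⊤)
open import Data.Product using (Σ; _×_)
open import Function.Bundles using (_⇔_)

open import Data.Bool using (true) renaming (_≟_ to _≟ᵇ_)
open import Data.Empty using (⊥; ⊥-elim)
open import Data.Fin using () renaming (_≟_ to _≟ᶠ_)
open import Data.Fin.Properties using (any?)
open import Data.Fin.Subset
  using (Subset; ∣_∣; ⋃; Nonempty; Empty; _∩_; _∪_; _─_; ⁅_⁆; _⊆_; _⊂_; inside; outside)
  renaming (_∈_ to _∈ₛ_; _∉_ to _∉ₛ_)
open import Data.Fin.Subset.Properties
  using (_∈?_; ⊆-antisym; p⊂q⇒∣p∣<∣q∣; ∣p∣≤n; ∣p∣≡n⇒p≡⊤; ∈⊤; x∈p∪q⁻; x∈p∪q⁺; x∈p∩q⁻; x∈p∩q⁺; ∉⊥;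
         Empty-unique; x∈⁅x⁆; x∈⁅y⁆⇒x≡y; ∣⁅x⁆∣≡1; p⊆q⇒∣p∣≤∣q∣; nonempty?; p∩q≢∅⇒∣p─q∣<∣p∣;
         x∈p∧x∉q⇒x∈p─q; p─q⊆p)
open import Data.List using (List; []; _∷_; _++_; length; filter; allFin)
open import Data.List.Properties using (++-identityʳ; ++-assoc; ∷-injectiveʳ)
open import Data.List.Membership.Propositional using (_∈_; _∉_)
open import Data.List.Membership.Propositional.Properties
  using (∈-++⁺ˡ; ∈-++⁺ʳ; ∈-++⁻; ∈-filter⁺; ∈-filter⁻; ∈-allFin)
open import Data.List.Relation.Binary.Permutation.Propositional using (_↭_; ↭-sym)
open import Data.List.Relation.Binary.Permutation.Propositional.Properties using (∈-resp-↭)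
open import Data.List.Relation.Binary.Pointwise using (Pointwise; []; _∷_)
open import Data.List.Relation.Unary.All using (All; []; _∷_)
import Data.List.Relation.Unary.All as All
import Data.List.Relation.Unary.All.Properties as All
open import Data.List.Relation.Unary.AllPairs using (AllPairs; []; _∷_)
open import Data.List.Relation.Unary.Any using (here; there)
open import Data.List.Relation.Unary.Unique.Propositional using (Unique)
open import Data.Maybe using (just; nothing)
open import Data.Nat using (zero; suc; _≤_; _<_; _+_; s≤s; z≤n) renaming (_≟_ to _≟ℕ_)
open import Data.Nat.Properties
  using (+-suc; +-identityʳ; ≤-refl; ≤-trans; ≤-antisym; <-≤-trans; ≤-pred; n≤1+n; m≤n+m; +-monoˡ-≤)
open import Data.Product using (∃; _,_; proj₁; proj₂)
open import Data.Sum using (_⊎_; inj₁; inj₂)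
open import Data.Vec using (_∷_)
open import Data.Vec.Base using () renaming (here to hereᵥ; there to thereᵥ)
open import Function using (_∘_)
open import Function.Bundles using (mk⇔; Equivalence)
open import Function.Construct.Composition using (_⇔-∘_)
open import Function.Construct.Identity using (⇔-id)
open import Relation.Binary.Construct.Closure.ReflexiveTransitive
  using (Star; ε; _◅_; _◅◅_; gmap; reverse)
open import Relation.Binary.PropositionalEquality
open import Relation.Nullary using (¬_; yes; no; Dec)
open import Relation.Nullary.Decidable using (_×-dec_; _⊎-dec_; ¬?)

-- Root paths and their longest common prefix

⪯-refl : ∀ v → v ⪯ v
⪯-refl v = [] , sym (++-identityʳ v)

≡⇒⪯ : ∀ {v w} → v ≡ w → v ⪯ w
≡⇒⪯ {v} refl = ⪯-refl v

⪯-trans : ∀ {a b c} → a ⪯ b → b ⪯ c → a ⪯ c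
⪯-trans {c = c} (s , refl) (t , refl) = t ++ s , ++-assoc c t s

⪯-root : ∀ v → v ⪯ []
⪯-root v = v , refl

⪯-∷ : ∀ {i a b} → a ⪯ b → (i ∷ a) ⪯ (i ∷ b)
⪯-∷ (s , refl) = s , refl

⪯-∷⁻ : ∀ {i j a b} → (i ∷ a) ⪯ (j ∷ b) → i ≡ j × a ⪯ b
⪯-∷⁻ (s , refl) = refl , s , refl

root⋠∷ : ∀ {i a} → ¬ ([] ⪯ (i ∷ a))
root⋠∷ (s , ())

⪯-antisym : ∀ {a b} → a ⪯ b → b ⪯ a → a ≡ b
⪯-antisym {[]}    {[]}    p q = refl
⪯-antisym {[]}    {_ ∷ _} p q = ⊥-elim (root⋠∷ p)
⪯-antisym {_ ∷ _} {[]}    p q = ⊥-elim (root⋠∷ q)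
⪯-antisym {i ∷ a} {_ ∷ b} p q with ⪯-∷⁻ p | ⪯-∷⁻ q
... | refl , p′ | _ , q′ = cong (i ∷_) (⪯-antisym p′ q′)

≺⇒⋡ : ∀ {a b} → a ≺ b → ¬ b ⪯ a
≺⇒⋡ (p , a≢b) q = a≢b (⪯-antisym p q)

ancestors-total : ∀ {a p q} → a ⪯ p → a ⪯ q → p ⪯ q ⊎ q ⪯ p
ancestors-total {p = []}    {q}       _ _ = inj₂ (⪯-root q)
ancestors-total {p = _ ∷ _} {[]}      _ _ = inj₁ (⪯-root _)
ancestors-total {[]} {_ ∷ _} {_ ∷ _} r _ = ⊥-elim (root⋠∷ r)
ancestors-total {_ ∷ _} {_ ∷ _} {_ ∷ _} r₁ r₂ with ⪯-∷⁻ r₁ | ⪯-∷⁻ r₂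
... | refl , r₁′ | refl , r₂′ with ancestors-total r₁′ r₂′
...   | inj₁ h = inj₁ (⪯-∷ h)
...   | inj₂ h = inj₂ (⪯-∷ h)

lcp-∷-≡ : ∀ i a b → lcp (i ∷ a) (i ∷ b) ≡ i ∷ lcp a b
lcp-∷-≡ i a b with i ≟ℕ i
... | yes _   = refl
... | no i≢i = ⊥-elim (i≢i refl)

lcp-∷-≢ : ∀ {i j} a b → i ≢ j → lcp (i ∷ a) (j ∷ b) ≡ []
lcp-∷-≢ {i} {j} a b i≢j with i ≟ℕ j
... | yes i≡j = ⊥-elim (i≢j i≡j)
... | no _    = refl

lcp-⪯ˡ : ∀ a b → a ⪯ lcp a b
lcp-⪯ˡ []      b       = ⪯-root []
lcp-⪯ˡ (_ ∷ _) []      = ⪯-root _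
lcp-⪯ˡ (i ∷ a) (j ∷ b) with i ≟ℕ j
... | yes _ = ⪯-∷ (lcp-⪯ˡ a b)
... | no _  = ⪯-root _

lcp-⪯ʳ : ∀ a b → b ⪯ lcp a b
lcp-⪯ʳ []      b       = ⪯-root b
lcp-⪯ʳ (_ ∷ _) []      = ⪯-root _
lcp-⪯ʳ (i ∷ a) (j ∷ b) with i ≟ℕ j
... | yes refl = ⪯-∷ (lcp-⪯ʳ a b)
... | no _     = ⪯-root _

lcp-comm : ∀ a b → lcp a b ≡ lcp b a
lcp-comm []      []      = refl
lcp-comm []      (_ ∷ _) = refl
lcp-comm (_ ∷ _) []      = refl
lcp-comm (i ∷ a) (j ∷ b) with i ≟ℕ j | j ≟ℕ i
... | yes refl | yes _   = cong (i ∷_) (lcp-comm a b)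
... | yes refl | no i≢i  = ⊥-elim (i≢i refl)
... | no i≢i   | yes refl = ⊥-elim (i≢i refl)
... | no _     | no _    = refl

lcp-idem : ∀ a → lcp a a ≡ a
lcp-idem []      = refl
lcp-idem (i ∷ a) = trans (lcp-∷-≡ i a a) (cong (i ∷_) (lcp-idem a))

lcp-greatest : ∀ {a b} p → a ⪯ p → b ⪯ p → lcp a b ⪯ p
lcp-greatest []      _ _ = ⪯-root _
lcp-greatest {[]}    (_ ∷ _) q₁ _ = ⊥-elim (root⋠∷ q₁)
lcp-greatest {_ ∷ _} {[]} (_ ∷ _) _ q₂ = ⊥-elim (root⋠∷ q₂)
lcp-greatest {i ∷ a} {_ ∷ b} (_ ∷ p) q₁ q₂ with ⪯-∷⁻ q₁ | ⪯-∷⁻ q₂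
... | refl , q₁′ | refl , q₂′ rewrite lcp-∷-≡ i a b = ⪯-∷ (lcp-greatest p q₁′ q₂′)

lcp-ultrametric : ∀ a b c → lcp a b ≺ lcp a c → lcp a c ≡ lcp b c
lcp-ultrametric []      b       c       (_ , ne) = ⊥-elim (ne refl)
lcp-ultrametric (i ∷ a) []      c       (p , ne) with lcp (i ∷ a) c
... | []    = ⊥-elim (ne refl)
... | _ ∷ _ = ⊥-elim (root⋠∷ p)
lcp-ultrametric (_ ∷ _) (_ ∷ _) []      _        = refl
lcp-ultrametric (i ∷ a) (j ∷ b) (l ∷ c) (p , ne) with i ≟ℕ j | i ≟ℕ l
... | no _     | yes refl = ⊥-elim (root⋠∷ p)
... | no _     | no _     = ⊥-elim (ne refl)
... | yes refl | no i≢l   = sym (lcp-∷-≢ b c i≢l)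
... | yes refl | yes refl = begin
  i ∷ lcp a c     ≡⟨ cong (i ∷_) (lcp-ultrametric a b c (proj₂ (⪯-∷⁻ p) , ne ∘ cong (i ∷_))) ⟩
  i ∷ lcp b c     ≡⟨ lcp-∷-≡ i b c ⟨
  lcp (i ∷ b) (i ∷ c) ∎
  where open ≡-Reasoning

lcp-cluster : ∀ {a b c} p → a ⪯ p → b ⪯ p → ¬ c ⪯ p
            → lcp a b ≺ lcp a c × lcp a c ≡ lcp b c
lcp-cluster {a} {b} {c} p a⪯p b⪯p c⋠p with ancestors-total (lcp-⪯ˡ a c) a⪯p
... | inj₁ ac⪯p = ⊥-elim (c⋠p (⪯-trans (lcp-⪯ʳ a c) ac⪯p))
... | inj₂ p⪯ac = ab≺ac , lcp-ultrametric a b c ab≺ac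
  where
  ab⪯p : lcp a b ⪯ p
  ab⪯p = lcp-greatest p a⪯p b⪯p
  ab≺ac : lcp a b ≺ lcp a c
  ab≺ac = ⪯-trans ab⪯p p⪯ac
        , λ e → c⋠p (⪯-trans (lcp-⪯ʳ a c) (subst (_⪯ p) e ab⪯p))

lcp-descendant : ∀ {a} p c → a ⪯ p → lcp p c ≡ p ⊎ lcp p c ≡ lcp a c
lcp-descendant []      c       _ = inj₁ refl
lcp-descendant {[]}    (_ ∷ _) c h = ⊥-elim (root⋠∷ h)
lcp-descendant {_ ∷ _} (_ ∷ _) [] h = inj₂ refl
lcp-descendant {_ ∷ a} (i ∷ p) (l ∷ c) h with ⪯-∷⁻ h
... | refl , h′ with i ≟ℕ l
... | no _ = inj₂ refl
... | yes refl with lcp-descendant p c h′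
...   | inj₁ e = inj₁ (cong (i ∷_) e)
...   | inj₂ e = inj₂ (cong (i ∷_) e)

data Bit : ℕ → Set where
  bit0 : Bit 0
  bit1 : Bit 1

bit-pigeonhole : ∀ {i j l} → Bit i → Bit j → Bit l → i ≢ j → i ≢ l → j ≡ l
bit-pigeonhole bit0 bit0 _    i≢j _   = ⊥-elim (i≢j refl)
bit-pigeonhole bit0 bit1 bit0 _   i≢l = ⊥-elim (i≢l refl)
bit-pigeonhole bit0 bit1 bit1 _   _   = refl
bit-pigeonhole bit1 bit0 bit0 _   _   = refl
bit-pigeonhole bit1 bit0 bit1 _   i≢l = ⊥-elim (i≢l refl)
bit-pigeonhole bit1 bit1 _    i≢j _   = ⊥-elim (i≢j refl)

-- In a binary tree, if a, b and c diverge at the same proper ancestor,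
-- b and c both leave it on the side away from a, so they diverge lower.
lcp-binary-branching : ∀ a b c → All Bit a → All Bit b → All Bit c
  → lcp a b ≡ lcp a c → lcp a b ≢ a → lcp a b ≢ b → lcp a c ≢ c
  → lcp b c ≺ lcp a b
lcp-binary-branching []      _       _       _ _ _ _ n₁ _ _ = ⊥-elim (n₁ refl)
lcp-binary-branching (_ ∷ _) []      _       _ _ _ _ _ n₂ _ = ⊥-elim (n₂ refl)
lcp-binary-branching (_ ∷ _) (_ ∷ _) []      _ _ _ _ _ _ n₃ = ⊥-elim (n₃ refl)
lcp-binary-branching (i ∷ a) (j ∷ b) (l ∷ c) (bi ∷ ba) (bj ∷ bb) (bl ∷ bc) e n₁ n₂ n₃
  with i ≟ℕ j | i ≟ℕ l
lcp-binary-branching (i ∷ a) (_ ∷ b) (l ∷ c) _ _ _ () _ _ _ | yes refl | no _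
lcp-binary-branching (i ∷ a) (j ∷ b) (_ ∷ c) _ _ _ () _ _ _ | no _ | yes refl
lcp-binary-branching (i ∷ a) (_ ∷ b) (_ ∷ c) (_ ∷ ba) (_ ∷ bb) (_ ∷ bc) e n₁ n₂ n₃ | yes refl | yes refl
  rewrite lcp-∷-≡ i b c
  with lcp-binary-branching a b c ba bb bc (∷-injectiveʳ e)
         (n₁ ∘ cong (i ∷_)) (n₂ ∘ cong (i ∷_)) (n₃ ∘ cong (i ∷_))
... | below , ne = ⪯-∷ below , ne ∘ ∷-injectiveʳ
lcp-binary-branching (i ∷ a) (j ∷ b) (l ∷ c) (bi ∷ _) (bj ∷ _) (bl ∷ _) _ _ _ _ | no i≢j | no i≢l
  with bit-pigeonhole bi bj bl i≢j i≢l
... | refl rewrite lcp-∷-≡ j b c = ⪯-root _ , λ ()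

-- Subtrees, leaf addresses and clusters

data Nth {A : Set} : List A → ℕ → A → Set where
  zero : ∀ {c cs} → Nth (c ∷ cs) 0 c
  suc  : ∀ {c d cs i} → Nth cs i c → Nth (d ∷ cs) (suc i) c

Nth⇒∈ : ∀ {A : Set} {cs : List A} {i c} → Nth cs i c → c ∈ cs
Nth⇒∈ zero    = here refl
Nth⇒∈ (suc p) = there (Nth⇒∈ p)

∈⇒Nth : ∀ {A : Set} {cs : List A} {c} → c ∈ cs → ∃ λ i → Nth cs i c
∈⇒Nth (here refl) = 0 , zero
∈⇒Nth (there p) with ∈⇒Nth p
... | i , q = suc i , suc q

Nth-functional : ∀ {A : Set} {cs : List A} {i c d} → Nth cs i c → Nth cs i d → c ≡ d
Nth-functional zero    zero    = refl
Nth-functional (suc p) (suc q) = Nth-functional p q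

Unique-++⁻ : ∀ {A : Set} (xs : List A) {ys} → Unique (xs ++ ys)
           → Unique xs × Unique ys × (∀ {x} → x ∈ xs → x ∉ ys)
Unique-++⁻ []       u = [] , u , λ ()
Unique-++⁻ (x ∷ xs) (x∉ ∷ u) with Unique-++⁻ xs u
... | uxs , uys , disjoint = All.++⁻ˡ xs x∉ ∷ uxs , uys , disjoint′
  where
  disjoint′ : ∀ {y} → y ∈ x ∷ xs → y ∉ _
  disjoint′ (here refl) y∈ = All.lookup (All.++⁻ʳ xs x∉) y∈ refl
  disjoint′ (there y∈)  = disjoint y∈

module _ {n : ℕ} where

  leavesList-++ : (xs ys : List (Tree n)) → leavesList (xs ++ ys) ≡ leavesList xs ++ leavesList ys
  leavesList-++ []       ys = refl
  leavesList-++ (x ∷ xs) ys = trans (cong (leaves x ++_) (leavesList-++ xs ys))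
                                    (sym (++-assoc (leaves x) _ _))

  ∈-leavesList⁻ : ∀ {x} (cs : List (Tree n)) → x ∈ leavesList cs → ∃ λ c → c ∈ cs × x ∈ leaves c
  ∈-leavesList⁻ (c ∷ cs) x∈ with ∈-++⁻ (leaves c) x∈
  ... | inj₁ h = c , here refl , h
  ... | inj₂ h with ∈-leavesList⁻ cs h
  ...   | d , d∈ , x∈d = d , there d∈ , x∈d

  ∈-leavesList⁺ : ∀ {x c} {cs : List (Tree n)} → c ∈ cs → x ∈ leaves c → x ∈ leavesList cs
  ∈-leavesList⁺ (here refl) x∈ = ∈-++⁺ˡ x∈
  ∈-leavesList⁺ {cs = d ∷ _} (there c∈) x∈ = ∈-++⁺ʳ (leaves d) (∈-leavesList⁺ c∈ x∈)

  data SubtreeAt : Tree n → Vertex → Tree n → Set where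
    root  : ∀ {T} → SubtreeAt T [] T
    child : ∀ {cs i c p S} → Nth cs i c → SubtreeAt c p S → SubtreeAt (node cs) (i ∷ p) S

  subtreeAt-++ : ∀ {T p S q S′} → SubtreeAt T p S → SubtreeAt S q S′ → SubtreeAt T (p ++ q) S′
  subtreeAt-++ root          b = b
  subtreeAt-++ (child i a) b = child i (subtreeAt-++ a b)

  subtreeAt-++⁻ : ∀ {T} p {q S} → SubtreeAt T (p ++ q) S
                → ∃ λ S′ → SubtreeAt T p S′ × SubtreeAt S′ q S
  subtreeAt-++⁻ []      a = _ , root , a
  subtreeAt-++⁻ (_ ∷ p) (child i a) with subtreeAt-++⁻ p a
  ... | S′ , a₁ , a₂ = S′ , child i a₁ , a₂

  subtreeAt-functional : ∀ {T p S S′} → SubtreeAt T p S → SubtreeAt T p S′ → S ≡ S′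
  subtreeAt-functional root        root        = refl
  subtreeAt-functional (child i a) (child j b) with Nth-functional i j
  ... | refl = subtreeAt-functional a b

  subtreeAt-leaves : ∀ {T p S x} → SubtreeAt T p S → x ∈ leaves S → x ∈ leaves T
  subtreeAt-leaves root        x∈ = x∈
  subtreeAt-leaves (child i a) x∈ = ∈-leavesList⁺ (Nth⇒∈ i) (subtreeAt-leaves a x∈)

  subtreeAt-leaf : ∀ {T p x} → SubtreeAt T p (leaf x) → x ∈ leaves T
  subtreeAt-leaf a = subtreeAt-leaves a (here refl)

  addrM-sound : ∀ T x p → addrM T x ≡ just p → SubtreeAt T p (leaf x)
  addrMList-sound : ∀ i (cs : List (Tree n)) x p → addrMList i cs x ≡ just p
    → ∃ λ j → ∃ λ c → ∃ λ q → p ≡ (i + j) ∷ q × Nth cs j c × SubtreeAt c q (leaf x)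
  addrM-sound (leaf y) x p eq with x ≟ᶠ y
  addrM-sound (leaf y) x p refl | yes refl = root
  addrM-sound (leaf y) x p ()   | no _
  addrM-sound (node cs) x p eq with addrMList-sound 0 cs x p eq
  ... | j , c , q , refl , j-th , a = child j-th a
  addrMList-sound i (c ∷ cs) x p eq with addrM c x in e
  addrMList-sound i (c ∷ cs) x p refl | just q =
    0 , c , q , cong (_∷ q) (sym (+-identityʳ i)) , zero , addrM-sound c x q e
  ... | nothing with addrMList-sound (suc i) cs x p eq
  ...   | j , d , q , refl , j-th , a = suc j , d , q , cong (_∷ q) (sym (+-suc i j)) , suc j-th , a

  addrM-complete : ∀ T x → x ∈ leaves T → ∃ λ p → addrM T x ≡ just p
  addrMList-complete : ∀ i (cs : List (Tree n)) x → x ∈ leavesList cs → ∃ λ p → addrMList i cs x ≡ just p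
  addrM-complete (leaf y) x x∈ with x ≟ᶠ y
  ... | yes _ = [] , refl
  addrM-complete (leaf y) x (here refl) | no x≢x = ⊥-elim (x≢x refl)
  addrM-complete (node cs) x x∈ = addrMList-complete 0 cs x x∈
  addrMList-complete i (c ∷ cs) x x∈ with addrM c x in e
  ... | just q  = i ∷ q , refl
  ... | nothing with ∈-++⁻ (leaves c) x∈
  ...   | inj₂ h = addrMList-complete (suc i) cs x h
  ...   | inj₁ h with addrM-complete c x h
  ...     | _ , e′ with () ← trans (sym e) e′

  addrM≡just⇒addr≡ : ∀ {T : Tree n} {x p} → addrM T x ≡ just p → addr T x ≡ p
  addrM≡just⇒addr≡ {T} {x} eq with addrM T x | eq
  ... | just _ | refl = refl

  subtreeAt-addr : ∀ {T : Tree n} {x} → x ∈ leaves T → SubtreeAt T (addr T x) (leaf x)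
  subtreeAt-addr {T} {x} x∈ with addrM-complete T x x∈
  ... | p , eq =
    subst (λ v → SubtreeAt T v (leaf x)) (sym (addrM≡just⇒addr≡ {T} eq)) (addrM-sound T x p eq)

  Unique-leaves-child : ∀ {cs : List (Tree n)} {j c} → Unique (leavesList cs) → Nth cs j c
                      → Unique (leaves c)
  Unique-leaves-child {c ∷ _} u zero        = proj₁ (Unique-++⁻ (leaves c) u)
  Unique-leaves-child {d ∷ _} u (suc j-th) =
    Unique-leaves-child (proj₁ (proj₂ (Unique-++⁻ (leaves d) u))) j-th

  Unique-leaves-disjoint : ∀ {cs : List (Tree n)} {i j c d x} → Unique (leavesList cs)
    → Nth cs i c → Nth cs j d → i ≢ j → x ∈ leaves c → x ∉ leaves d
  Unique-leaves-disjoint u zero zero i≢j _ _ = i≢j refl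
  Unique-leaves-disjoint {e ∷ _} u zero (suc j-th) _ x∈c x∈d =
    proj₂ (proj₂ (Unique-++⁻ (leaves e) u)) x∈c (∈-leavesList⁺ (Nth⇒∈ j-th) x∈d)
  Unique-leaves-disjoint {e ∷ _} u (suc i-th) zero _ x∈c x∈d =
    proj₂ (proj₂ (Unique-++⁻ (leaves e) u)) x∈d (∈-leavesList⁺ (Nth⇒∈ i-th) x∈c)
  Unique-leaves-disjoint {e ∷ _} u (suc i-th) (suc j-th) i≢j =
    Unique-leaves-disjoint (proj₁ (proj₂ (Unique-++⁻ (leaves e) u))) i-th j-th (i≢j ∘ cong suc)

  subtreeAt-leaf-unique : ∀ {T : Tree n} {p q x} → Unique (leaves T)
    → SubtreeAt T p (leaf x) → SubtreeAt T q (leaf x) → p ≡ q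
  subtreeAt-leaf-unique u root root = refl
  subtreeAt-leaf-unique u (child {i = i} i-th a) (child {i = j} j-th b) with i ≟ℕ j
  ... | no i≢j = ⊥-elim (Unique-leaves-disjoint u i-th j-th i≢j (subtreeAt-leaf a) (subtreeAt-leaf b))
  ... | yes refl with Nth-functional i-th j-th
  ...   | refl = cong (i ∷_) (subtreeAt-leaf-unique (Unique-leaves-child u i-th) a b)

  subtreeAt-leaf-below : ∀ {T : Tree n} {p q x y}
    → SubtreeAt T p (leaf x) → SubtreeAt T (p ++ q) (leaf y) → x ≡ y
  subtreeAt-leaf-below {p = p} a b with subtreeAt-++⁻ p b
  ... | _ , a₁ , a₂ with subtreeAt-functional a a₁
  subtreeAt-leaf-below a b | _ , _ , root | refl = refl

  addr-⪯⇒∈-subtree : ∀ {T : Tree n} {p S x} → SubtreeAt T p S → x ∈ leaves T → addr T x ⪯ p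
                    → x ∈ leaves S
  addr-⪯⇒∈-subtree {T} {p} {x = x} a x∈ (s , e)
    with subtreeAt-++⁻ p (subst (λ v → SubtreeAt T v (leaf x)) e (subtreeAt-addr x∈))
  ... | _ , a₁ , a₂ with subtreeAt-functional a a₁
  ...   | refl = subtreeAt-leaf a₂

  module _ {T : Tree n} (U : Unique (leaves T)) where

    addr-subtreeAt : ∀ {p x} → SubtreeAt T p (leaf x) → addr T x ≡ p
    addr-subtreeAt a = subtreeAt-leaf-unique U (subtreeAt-addr (subtreeAt-leaf a)) a

    addr-⪯-subtree : ∀ {p S x} → SubtreeAt T p S → x ∈ leaves S → addr T x ⪯ p
    addr-⪯-subtree a x∈ = _ , addr-subtreeAt (subtreeAt-++ a (subtreeAt-addr x∈))

    addr-⪯⇒≡ : ∀ {x y} → x ∈ leaves T → y ∈ leaves T → addr T y ⪯ addr T x → y ≡ x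
    addr-⪯⇒≡ {x} {y} x∈ y∈ (s , e) =
      sym (subtreeAt-leaf-below (subtreeAt-addr x∈)
                                (subst (λ v → SubtreeAt T v (leaf y)) e (subtreeAt-addr y∈)))

  ClusterDisplays : Tree n → Fin n → Fin n → Fin n → Set
  ClusterDisplays T a b c =
    ∃ λ p → ∃ λ S → SubtreeAt T p S × a ∈ leaves S × b ∈ leaves S × c ∉ leaves S

  clusterDisplays⇒displays : ∀ {T : Tree n} {a b c} → Unique (leaves T) → c ∈ leaves T
    → a ≢ b → a ≢ c → b ≢ c → ClusterDisplays T a b c → Displays T a b c
  clusterDisplays⇒displays U c∈ a≢b a≢c b≢c (p , S , at , a∈ , b∈ , c∉) =
    a≢b , a≢c , b≢c , lcp-cluster p (addr-⪯-subtree U at a∈) (addr-⪯-subtree U at b∈)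
                                    (c∉ ∘ addr-⪯⇒∈-subtree at c∈)

  displays⇒clusterDisplays : ∀ {T : Tree n} {a b c} → Unique (leaves T)
    → a ∈ leaves T → b ∈ leaves T → Displays T a b c → ClusterDisplays T a b c
  displays⇒clusterDisplays {T} {a} {b} {c} U a∈ b∈ (_ , _ , _ , ab≺ac , _)
    with subtreeAt-++⁻ (lca T a b) (at-lca a∈ (lcp-⪯ˡ (addr T a) (addr T b)))
       | subtreeAt-++⁻ (lca T a b) (at-lca b∈ (lcp-⪯ʳ (addr T a) (addr T b)))
    where
    at-lca : ∀ {x} → x ∈ leaves T → (h : addr T x ⪯ lca T a b)
           → SubtreeAt T (lca T a b ++ proj₁ h) (leaf x)
    at-lca {x} x∈ (_ , e) = subst (λ v → SubtreeAt T v (leaf x)) e (subtreeAt-addr x∈)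
  ... | S , at , a-at | _ , at′ , b-at with subtreeAt-functional at at′
  ... | refl = lca T a b , S , at , subtreeAt-leaf a-at , subtreeAt-leaf b-at , c∉
    where
    c∉ : c ∉ leaves S
    c∉ c∈ = ≺⇒⋡ ab≺ac (lcp-greatest (lca T a b) (lcp-⪯ˡ (addr T a) (addr T b)) (addr-⪯-subtree U at c∈))

  -- Refinement and binarization

  SameLeaves : Tree n → Tree n → Set
  SameLeaves S S′ = ∀ x → x ∈ leaves S ⇔ x ∈ leaves S′

  leavesList-contract : ∀ pre ds post
    → leavesList (pre ++ node ds ∷ post) ≡ leavesList (pre ++ ds ++ post)
  leavesList-contract pre ds post = begin
    leavesList (pre ++ node ds ∷ post)
      ≡⟨ leavesList-++ pre (node ds ∷ post) ⟩
    leavesList pre ++ leavesList ds ++ leavesList post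
      ≡⟨ cong (leavesList pre ++_) (leavesList-++ ds post) ⟨
    leavesList pre ++ leavesList (ds ++ post)
      ≡⟨ leavesList-++ pre (ds ++ post) ⟨
    leavesList (pre ++ ds ++ post) ∎
    where open ≡-Reasoning

  leavesList-↭ : ∀ {cs ds : List (Tree n)} {x} → cs ↭ ds → x ∈ leavesList cs → x ∈ leavesList ds
  leavesList-↭ {cs} cs↭ds x∈ with ∈-leavesList⁻ cs x∈
  ... | c , c∈ , x∈c = ∈-leavesList⁺ (∈-resp-↭ cs↭ds c∈) x∈c

  leavesList-replace : ∀ pre {c c′ : Tree n} post {x}
    → (∀ {y} → y ∈ leaves c → y ∈ leaves c′)
    → x ∈ leavesList (pre ++ c ∷ post) → x ∈ leavesList (pre ++ c′ ∷ post)
  leavesList-replace pre post c⊆c′ x∈ with ∈-leavesList⁻ (pre ++ _ ∷ post) x∈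
  ... | d , d∈ , x∈d with ∈-++⁻ pre d∈
  ...   | inj₁ d∈pre          = ∈-leavesList⁺ (∈-++⁺ˡ d∈pre) x∈d
  ...   | inj₂ (here refl)    = ∈-leavesList⁺ (∈-++⁺ʳ pre (here refl)) (c⊆c′ x∈d)
  ...   | inj₂ (there d∈post) = ∈-leavesList⁺ (∈-++⁺ʳ pre (there d∈post)) x∈d

  step-sameLeaves : ∀ {T T′ : Tree n} → Step T T′ → SameLeaves T T′
  step-sameLeaves (contract pre ds post) x =
    mk⇔ (subst (x ∈_) (leavesList-contract pre ds post))
        (subst (x ∈_) (sym (leavesList-contract pre ds post)))
  step-sameLeaves (reorder cs↭ds) x = mk⇔ (leavesList-↭ cs↭ds) (leavesList-↭ (↭-sym cs↭ds))
  step-sameLeaves (inside pre post st) x =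
    mk⇔ (leavesList-replace pre post (Equivalence.to (step-sameLeaves st _)))
        (leavesList-replace pre post (Equivalence.from (step-sameLeaves st _)))

  subtreeAt-∈-child : ∀ {cs : List (Tree n)} {c p S} → c ∈ cs → SubtreeAt c p S
                    → ∃ λ q → SubtreeAt (node cs) q S
  subtreeAt-∈-child c∈ a with ∈⇒Nth c∈
  ... | _ , i-th = _ , child i-th a

  step-reflects-subtree : ∀ {T T′ : Tree n} {p′ S′} → Step T T′ → SubtreeAt T′ p′ S′
    → ∃ λ p → ∃ λ S → SubtreeAt T p S × SameLeaves S S′
  step-reflects-subtree st root = _ , _ , root , step-sameLeaves st
  step-reflects-subtree {S′ = S′} st (child i-th a) = lift st (Nth⇒∈ i-th) a
    where
    same : ∀ {T p} → SubtreeAt T p S′ → ∃ λ p → ∃ λ S → SubtreeAt T p S × SameLeaves S S′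
    same a = _ , S′ , a , λ _ → ⇔-id _
    lift : ∀ {T cs′ c p} → Step T (node cs′) → c ∈ cs′ → SubtreeAt c p S′
         → ∃ λ p → ∃ λ S → SubtreeAt T p S × SameLeaves S S′
    lift (contract pre ds post) c∈ a with ∈-++⁻ pre c∈
    ... | inj₁ c∈pre = same (proj₂ (subtreeAt-∈-child (∈-++⁺ˡ c∈pre) a))
    ... | inj₂ c∈ds++post with ∈-++⁻ ds c∈ds++post
    ...   | inj₁ c∈ds   = same (proj₂ (subtreeAt-∈-child (∈-++⁺ʳ pre (here refl))
                                                          (proj₂ (subtreeAt-∈-child c∈ds a))))
    ...   | inj₂ c∈post = same (proj₂ (subtreeAt-∈-child (∈-++⁺ʳ pre (there c∈post)) a))
    lift (reorder cs↭cs′) c∈ a = same (proj₂ (subtreeAt-∈-child (∈-resp-↭ (↭-sym cs↭cs′) c∈) a))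
    lift (inside pre post st) c∈ a with ∈-++⁻ pre c∈
    ... | inj₁ c∈pre          = same (proj₂ (subtreeAt-∈-child (∈-++⁺ˡ c∈pre) a))
    ... | inj₂ (there c∈post) = same (proj₂ (subtreeAt-∈-child (∈-++⁺ʳ pre (there c∈post)) a))
    ... | inj₂ (here refl) with step-reflects-subtree st a
    ...   | _ , S , a′ , e = _ , S , proj₂ (subtreeAt-∈-child (∈-++⁺ʳ pre (here refl)) a′) , e

  refines-reflects-subtree : ∀ {T T′ : Tree n} {p′ S′} → Refines T T′ → SubtreeAt T′ p′ S′
    → ∃ λ p → ∃ λ S → SubtreeAt T p S × SameLeaves S S′
  refines-reflects-subtree ε a = _ , _ , a , λ _ → ⇔-id _
  refines-reflects-subtree (st ◅ r) a with refines-reflects-subtree r a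
  ... | _ , _ , a₁ , e₁ with step-reflects-subtree st a₁
  ...   | _ , S , a₂ , e₂ = _ , S , a₂ , λ x → e₁ x ⇔-∘ e₂ x

  refines-clusterDisplays : ∀ {T T′ : Tree n} {a b c} → Refines T T′
    → ClusterDisplays T′ a b c → ClusterDisplays T a b c
  refines-clusterDisplays r (_ , _ , at , a∈ , b∈ , c∉) with refines-reflects-subtree r at
  ... | p , S , at′ , e = p , S , at′ , from (e _) a∈ , from (e _) b∈ , c∉ ∘ to (e _)
    where open Equivalence

  -- a node (c₁ … c_k) becomes the caterpillar ((…(c₁ c₂) c₃ …) c_k)
  binarize : Tree n → Tree n
  binarizeOnto : Tree n → List (Tree n) → Tree n
  binarize (leaf x)            = leaf x
  binarize (node [])           = node []
  binarize (node (c ∷ []))     = node (c ∷ [])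
  binarize (node (c ∷ d ∷ ds)) = binarizeOnto (node (binarize c ∷ binarize d ∷ [])) ds
  binarizeOnto acc []       = acc
  binarizeOnto acc (d ∷ ds) = binarizeOnto (node (acc ∷ binarize d ∷ [])) ds

  binarize-leaves : ∀ T → leaves (binarize T) ≡ leaves T
  binarizeOnto-leaves : ∀ acc ds → leaves (binarizeOnto acc ds) ≡ leaves acc ++ leavesList ds
  binarize-leaves (leaf x)            = refl
  binarize-leaves (node [])           = refl
  binarize-leaves (node (c ∷ []))     = refl
  binarize-leaves (node (c ∷ d ∷ ds)) = begin
    leaves (binarizeOnto (node (binarize c ∷ binarize d ∷ [])) ds)
      ≡⟨ binarizeOnto-leaves _ ds ⟩
    (leaves (binarize c) ++ leaves (binarize d) ++ []) ++ leavesList ds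
      ≡⟨ cong₂ (λ u v → (u ++ v) ++ leavesList ds) (binarize-leaves c)
               (trans (++-identityʳ _) (binarize-leaves d)) ⟩
    (leaves c ++ leaves d) ++ leavesList ds
      ≡⟨ ++-assoc (leaves c) (leaves d) (leavesList ds) ⟩
    leaves c ++ leaves d ++ leavesList ds ∎
    where open ≡-Reasoning
  binarizeOnto-leaves acc []       = sym (++-identityʳ (leaves acc))
  binarizeOnto-leaves acc (d ∷ ds) = begin
    leaves (binarizeOnto (node (acc ∷ binarize d ∷ [])) ds)
      ≡⟨ binarizeOnto-leaves _ ds ⟩
    (leaves acc ++ leaves (binarize d) ++ []) ++ leavesList ds
      ≡⟨ cong (λ v → (leaves acc ++ v) ++ leavesList ds) (trans (++-identityʳ _) (binarize-leaves d)) ⟩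
    (leaves acc ++ leaves d) ++ leavesList ds
      ≡⟨ ++-assoc (leaves acc) (leaves d) (leavesList ds) ⟩
    leaves acc ++ leaves d ++ leavesList ds ∎
    where open ≡-Reasoning

  binarize-binary : ∀ {T : Tree n} → Phylo T → Binary (binarize T)
  binarizeOnto-binary : ∀ {acc : Tree n} {ds} → Binary acc → All Phylo ds → Binary (binarizeOnto acc ds)
  binarize-binary (leaf x) = leaf x
  binarize-binary (node {c ∷ d ∷ _} _ (pc ∷ pd ∷ pds)) =
    binarizeOnto-binary (node (binarize-binary pc) (binarize-binary pd)) pds
  binarize-binary (node (s≤s ()) (_ ∷ []))
  binarizeOnto-binary b []          = b
  binarizeOnto-binary b (pd ∷ pds) = binarizeOnto-binary (node b (binarize-binary pd)) pds

  refines-inside : ∀ (pre : List (Tree n)) {c c′} post → Refines c c′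
                 → Refines (node (pre ++ c ∷ post)) (node (pre ++ c′ ∷ post))
  refines-inside pre post = gmap (λ c → node (pre ++ c ∷ post)) (inside pre post)

  binarize-refines : ∀ T → Refines (binarize T) T
  binarizeOnto-refines : ∀ acc cs ds → Refines acc (node cs)
                       → Refines (binarizeOnto acc ds) (node (cs ++ ds))
  binarize-refines (leaf x)            = ε
  binarize-refines (node [])           = ε
  binarize-refines (node (c ∷ []))     = ε
  binarize-refines (node (c ∷ d ∷ ds)) =
    binarizeOnto-refines _ (c ∷ d ∷ []) ds
      (refines-inside [] (binarize d ∷ []) (binarize-refines c)
        ◅◅ refines-inside (c ∷ []) [] (binarize-refines d))
  binarizeOnto-refines acc cs []       r = subst (λ v → Refines acc (node v)) (sym (++-identityʳ cs)) r
  binarizeOnto-refines acc cs (d ∷ ds) r =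
    subst (λ v → Refines (binarizeOnto (node (acc ∷ binarize d ∷ [])) ds) (node v))
          (++-assoc cs (d ∷ []) ds)
      (binarizeOnto-refines _ (cs ++ d ∷ []) ds
        (refines-inside [] (binarize d ∷ []) r
          ◅◅ refines-inside (node cs ∷ []) [] (binarize-refines d)
          ◅◅ contract [] cs (d ∷ []) ◅ ε))

  binary-path-bits : ∀ {T : Tree n} {p S} → Binary T → SubtreeAt T p S → All Bit p
  binary-path-bits _ root = []
  binary-path-bits (node bl _) (child zero a)             = bit0 ∷ binary-path-bits bl a
  binary-path-bits (node _ br) (child (suc zero) a)       = bit1 ∷ binary-path-bits br a
  binary-path-bits (node _ _)  (child (suc (suc ())) _)

  Binary⇒Phylo : ∀ {T : Tree n} → Binary T → Phylo T
  Binary⇒Phylo (leaf x)   = leaf x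
  Binary⇒Phylo (node l r) = node (s≤s (s≤s z≤n)) (Binary⇒Phylo l ∷ Binary⇒Phylo r ∷ [])

  Phylo⇒leaf : ∀ {T : Tree n} → Phylo T → ∃ λ x → x ∈ leaves T
  Phylo⇒leaf (leaf x) = x , here refl
  Phylo⇒leaf (node {c ∷ cs} _ (pc ∷ _)) with Phylo⇒leaf pc
  ... | x , x∈ = x , ∈-leavesList⁺ {cs = c ∷ cs} (here refl) x∈

  binarize-phyloOn : ∀ {T : Tree n} → PhyloOn T → PhyloOn (binarize T)
  binarize-phyloOn {T} (PT , U , T∋) =
    Binary⇒Phylo (binarize-binary PT) , subst Unique (sym (binarize-leaves T)) U
    , λ x → subst (x ∈_) (sym (binarize-leaves T)) (T∋ x)

  refinement-displays : ∀ {T T′ : Tree n} {R : Triples {n}} → PhyloOn T → Refines T T′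
    → (∀ a b c → R a b c → a ≢ b × a ≢ c × b ≢ c)
    → (∀ a b c → R a b c → ClusterDisplays T′ a b c)
    → ∀ a b c → R a b c → Displays T a b c
  refinement-displays (_ , U , T∋) T≤T′ distinct clusters a b c r with distinct a b c r
  ... | a≢b , a≢c , b≢c =
    clusterDisplays⇒displays U (T∋ c) a≢b a≢c b≢c (refines-clusterDisplays T≤T′ (clusters a b c r))

-- Triples of a qBMG in an explaining tree

module _ {n k : ℕ} (G : Digraph {n}) (σ : Fin n → Fin k) where

  ℛᴮ-distinct : ∀ {a b c} → ℛᴮ G σ a b c → a ≢ b × a ≢ c × b ≢ c
  ℛᴮ-distinct (inj₁ (σa≢σb , σb≡σc , ab , ¬ac)) =
    σa≢σb ∘ cong σ , (λ a≡c → σa≢σb (trans (cong σ a≡c) (sym σb≡σc)))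
    , λ b≡c → ¬ac (subst (Arc G _) b≡c ab)
  ℛᴮ-distinct (inj₂ (σc≢σa , σa≡σb , a≢b , _ , _)) =
    a≢b , σc≢σa ∘ sym ∘ cong σ , λ b≡c → σc≢σa (trans (sym (cong σ b≡c)) (sym σa≡σb))

  ℛᴮ? : ∀ a b c → Dec (ℛᴮ G σ a b c)
  ℛᴮ? a b c =
    (¬? (σ a ≟ᶠ σ b) ×-dec (σ b ≟ᶠ σ c) ×-dec (G a b ≟ᵇ true) ×-dec ¬? (G a c ≟ᵇ true))
    ⊎-dec (¬? (σ c ≟ᶠ σ a) ×-dec (σ a ≟ᶠ σ b) ×-dec ¬? (a ≟ᶠ b)
           ×-dec (G c a ≟ᵇ true) ×-dec (G c b ≟ᵇ true))

  module _ (T : Tree n) (u : Fin n → Fin k → Vertex) (E : Explains T σ u G) where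

    private
      U : Unique (leaves T)
      U = proj₁ (proj₂ (proj₁ E))
      T∋ : ∀ x → x ∈ leaves T
      T∋ = proj₂ (proj₂ (proj₁ E))
      arc⇔qbm : ∀ x y → Arc G x y ⇔ QuasiBestMatch T σ u x y
      arc⇔qbm = proj₂ (proj₂ E)
      open Equivalence

    explainer-displays-ℛ : ∀ {a b b′} → ℛ G σ a b b′ → Displays T a b b′
    explainer-displays-ℛ {a} {b} {b′} r@(σa≢σb , σb≡σb′ , ab , ¬ab′)
      with ℛᴮ-distinct (inj₁ r) | to (arc⇔qbm a b) ab
    ... | a≢b , a≢b′ , b≢b′ | (_ , best) , ab⪯u =
      a≢b , a≢b′ , b≢b′ , ab≺ab′ , lcp-ultrametric (addr T a) (addr T b) (addr T b′) ab≺ab′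
      where
      b′-quasiBest : lca T a b ≡ lca T a b′ → QuasiBestMatch T σ u a b′
      b′-quasiBest e =
        ( (λ σa≡σb′ → σa≢σb (trans σa≡σb′ (sym σb≡σb′)))
        , λ y′ σy′ → subst (_⪯ lca T a y′) e (best y′ (trans σy′ (sym σb≡σb′))))
        , subst₂ (λ v s → v ⪯ u a s) e σb≡σb′ ab⪯u
      ab≺ab′ : lca T a b ≺ lca T a b′
      ab≺ab′ = best b′ (sym σb≡σb′) , ¬ab′ ∘ from (arc⇔qbm a b′) ∘ b′-quasiBest

    binaryExplainer-displays-ℱ : Binary T → ∀ {a b b′} → ℱ G σ a b b′ → Displays T b b′ a
    binaryExplainer-displays-ℱ BT {a} {b} {b′} f@(_ , σb≡σb′ , _ , ab , ab′)
      with ℛᴮ-distinct (inj₂ f) | to (arc⇔qbm a b) ab | to (arc⇔qbm a b′) ab′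
    ... | b≢b′ , b≢a , b′≢a | (_ , best) , _ | (_ , best′) , _ =
      b≢b′ , b≢a , b′≢a , subst (lcp B B′ ≺_) (lcp-comm A B) bb′≺ab
      , trans (lcp-comm B A) (trans ab≡ab′ (lcp-comm A B′))
      where
      A B B′ : Vertex
      A = addr T a
      B = addr T b
      B′ = addr T b′
      ab≡ab′ : lcp A B ≡ lcp A B′
      ab≡ab′ = ⪯-antisym (best b′ (sym σb≡σb′)) (best′ b σb≡σb′)
      not-leaf : ∀ {x y} → x ≢ y → lcp (addr T x) (addr T y) ≢ addr T x
      not-leaf {x} {y} x≢y e =
        x≢y (sym (addr-⪯⇒≡ {T = T} U (T∋ x) (T∋ y) (subst (addr T y ⪯_) e (lcp-⪯ʳ (addr T x) (addr T y)))))
      bits : ∀ x → All Bit (addr T x)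
      bits x = binary-path-bits BT (subtreeAt-addr (T∋ x))
      bb′≺ab : lcp B B′ ≺ lcp A B
      bb′≺ab = lcp-binary-branching A B B′ (bits a) (bits b) (bits b′) ab≡ab′
                 (not-leaf (b≢a ∘ sym)) (λ e → not-leaf b≢a (trans (lcp-comm B A) e))
                 (λ e → not-leaf b′≢a (trans (lcp-comm B′ A) e))

    binaryExplainer-displays-ℛᴮ : Binary T → ∀ a b c → ℛᴮ G σ a b c → Displays T a b c
    binaryExplainer-displays-ℛᴮ _  a b c (inj₁ r) = explainer-displays-ℛ r
    binaryExplainer-displays-ℛᴮ BT a b c (inj₂ f) = binaryExplainer-displays-ℱ BT f

  module _ (proper : ProperlyColored G σ) (T : Tree n) (PT : PhyloOn T)
           (displays : ∀ a b c → ℛᴮ G σ a b c → Displays T a b c) where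

    private
      U : Unique (leaves T)
      U = proj₁ (proj₂ PT)
      T∋ : ∀ x → x ∈ leaves T
      T∋ = proj₂ (proj₂ PT)

    arc⇒colours-differ : ∀ {x y} → Arc G x y → σ x ≢ σ y
    arc⇒colours-differ {x} {y} xy σx≡σy = proj₁ (proper x y σx≡σy) xy

    arcs-same-colour-same-lca : ∀ {x y y′} → Arc G x y → Arc G x y′ → σ y ≡ σ y′
                              → lca T x y ≡ lca T x y′
    arcs-same-colour-same-lca {x} {y} {y′} xy xy′ σy≡σy′ with y ≟ᶠ y′
    ... | yes refl = refl
    ... | no y≢y′ with displays y y′ x (inj₂ (arc⇒colours-differ xy , σy≡σy′ , y≢y′ , xy , xy′))
    ...   | _ , _ , _ , _ , yx≡y′x =
      trans (lcp-comm (addr T x) (addr T y)) (trans yx≡y′x (lcp-comm (addr T y′) (addr T x)))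

    arc-nonarc-lca-≺ : ∀ {x y y′} → Arc G x y → ¬ Arc G x y′ → σ y ≡ σ y′
                     → lca T x y ≺ lca T x y′
    arc-nonarc-lca-≺ xy ¬xy′ σy≡σy′ =
      proj₁ (proj₂ (proj₂ (proj₂ (displays _ _ _ (inj₁ (arc⇒colours-differ xy , σy≡σy′ , xy , ¬xy′))))))

    HasOutNeighbourOfColour : Fin n → Fin k → Set
    HasOutNeighbourOfColour x s = ∃ λ b → σ b ≡ s × Arc G x b

    outNeighbourOfColour? : ∀ x s → Dec (HasOutNeighbourOfColour x s)
    outNeighbourOfColour? x s = any? λ b → (σ b ≟ᶠ s) ×-dec (G x b ≟ᵇ true)

    -- truncate at lca(x,b) for any out-neighbour b of colour s; they all agree
    truncateAt : ∀ x s → Dec (HasOutNeighbourOfColour x s) → Vertex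
    truncateAt x s (yes (b , _)) = lca T x b
    truncateAt x s (no _)        = addr T x

    truncation : Fin n → Fin k → Vertex
    truncation x s = truncateAt x s (outNeighbourOfColour? x s)

    truncation-isTruncation : IsTruncation T σ truncation
    truncation-isTruncation =
      (λ x s → on-path x s (outNeighbourOfColour? x s))
      , λ x → at-own-colour x (outNeighbourOfColour? x (σ x))
      where
      on-path : ∀ x s d → addr T x ⪯ truncateAt x s d
      on-path x s (yes (b , _)) = lcp-⪯ˡ (addr T x) (addr T b)
      on-path x s (no _)        = ⪯-refl _
      at-own-colour : ∀ x d → truncateAt x (σ x) d ≡ addr T x
      at-own-colour x (yes (b , σb≡σx , xb)) = ⊥-elim (arc⇒colours-differ xb (sym σb≡σx))
      at-own-colour x (no _)                 = refl

    arc⇒quasiBestMatch : ∀ {x y} → Arc G x y → QuasiBestMatch T σ truncation x y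
    arc⇒quasiBestMatch {x} {y} xy =
      (arc⇒colours-differ xy , best) , below (outNeighbourOfColour? x (σ y))
      where
      best : ∀ y′ → σ y′ ≡ σ y → lca T x y ⪯ lca T x y′
      best y′ σy′≡σy with G x y′ ≟ᵇ true
      ... | yes xy′ = ≡⇒⪯ (arcs-same-colour-same-lca xy xy′ (sym σy′≡σy))
      ... | no ¬xy′ = proj₁ (arc-nonarc-lca-≺ xy ¬xy′ (sym σy′≡σy))
      below : ∀ d → lca T x y ⪯ truncateAt x (σ y) d
      below (yes (b , σb≡σy , xb)) = ≡⇒⪯ (arcs-same-colour-same-lca xy xb (sym σb≡σy))
      below (no none)              = ⊥-elim (none (y , refl , xy))

    quasiBestMatch⇒arc : ∀ {x y} → QuasiBestMatch T σ truncation x y → Arc G x y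
    quasiBestMatch⇒arc {x} {y} ((σx≢σy , _) , xy⪯u) with G x y ≟ᵇ true
    ... | yes xy  = xy
    ... | no ¬xy = ⊥-elim (below (outNeighbourOfColour? x (σ y)) xy⪯u)
      where
      below : ∀ d → ¬ lca T x y ⪯ truncateAt x (σ y) d
      below (yes (b , σb≡σy , xb)) = ≺⇒⋡ (arc-nonarc-lca-≺ xb ¬xy σb≡σy)
      below (no _) xy⪯x = σx≢σy (cong σ (sym (addr-⪯⇒≡ {T = T} U (T∋ x) (T∋ y)
        (⪯-trans (lcp-⪯ʳ (addr T x) (addr T y)) (≡⇒⪯ (⪯-antisym xy⪯x (lcp-⪯ˡ (addr T x) (addr T y))))))))

    displaying-tree-explains : Explains T σ truncation G
    displaying-tree-explains =
      PT , truncation-isTruncation , λ x y → mk⇔ arc⇒quasiBestMatch quasiBestMatch⇒arc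

-- Connected components, the Aho graph and BUILD

x∈p─q⇒x∉q : ∀ {n} {x : Fin n} (p q : Subset n) → x ∈ₛ p ─ q → x ∉ₛ q
x∈p─q⇒x∉q (inside ∷ p) (outside ∷ q) hereᵥ = λ ()
x∈p─q⇒x∉q (_ ∷ p) (_ ∷ q) (thereᵥ x∈) (thereᵥ x∈q) = x∈p─q⇒x∉q p q x∈ x∈q

module _ {n : ℕ} where

  ∈-⋃⁻ : ∀ {x} (Cs : List (Subset n)) → x ∈ₛ ⋃ Cs → ∃ λ C → C ∈ Cs × x ∈ₛ C
  ∈-⋃⁻ []       x∈ = ⊥-elim (∉⊥ x∈)
  ∈-⋃⁻ (C ∷ Cs) x∈ with x∈p∪q⁻ C (⋃ Cs) x∈
  ... | inj₁ x∈C  = C , here refl , x∈C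
  ... | inj₂ x∈Cs with ∈-⋃⁻ Cs x∈Cs
  ...   | D , D∈ , x∈D = D , there D∈ , x∈D

  ∈-⋃⁺ : ∀ {C x} {Cs : List (Subset n)} → C ∈ Cs → x ∈ₛ C → x ∈ₛ ⋃ Cs
  ∈-⋃⁺ (here refl) x∈ = x∈p∪q⁺ (inj₁ x∈)
  ∈-⋃⁺ (there C∈)  x∈ = x∈p∪q⁺ (inj₂ (∈-⋃⁺ C∈ x∈))

  x∈p⇒1≤∣p∣ : ∀ {x} {p : Subset n} → x ∈ₛ p → 1 ≤ ∣ p ∣
  x∈p⇒1≤∣p∣ {x} {p} x∈ =
    subst (_≤ ∣ p ∣) (∣⁅x⁆∣≡1 x) (p⊆q⇒∣p∣≤∣q∣ λ y∈ → subst (_∈ₛ p) (sym (x∈⁅y⁆⇒x≡y x y∈)) x∈)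

  ∣p∣≡1⇒x≡y : ∀ {p : Subset n} {x y} → ∣ p ∣ ≡ 1 → x ∈ₛ p → y ∈ₛ p → x ≡ y
  ∣p∣≡1⇒x≡y {p} {x} {y} ∣p∣≡1 x∈ y∈ with x ≟ᶠ y
  ... | yes x≡y = x≡y
  ... | no x≢y with subst₂ _<_ (∣⁅x⁆∣≡1 x) ∣p∣≡1 (p⊂q⇒∣p∣<∣q∣ ⁅x⁆⊂p)
    where
    ⁅x⁆⊂p : ⁅ x ⁆ ⊂ p
    ⁅x⁆⊂p = (λ z∈ → subst (_∈ₛ p) (sym (x∈⁅y⁆⇒x≡y x z∈)) x∈) , y , y∈ , x≢y ∘ sym ∘ x∈⁅y⁆⇒x≡y x
  ...   | s≤s ()

  singleton⇒∣p∣≡1 : ∀ {p : Subset n} {x} → x ∈ₛ p → (∀ y → y ∈ₛ p → y ≡ x) → ∣ p ∣ ≡ 1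
  singleton⇒∣p∣≡1 {p} {x} x∈ only-x = trans (cong ∣_∣ p≡⁅x⁆) (∣⁅x⁆∣≡1 x)
    where
    p≡⁅x⁆ : p ≡ ⁅ x ⁆
    p≡⁅x⁆ = ⊆-antisym (λ {y} y∈ → subst (_∈ₛ ⁅ x ⁆) (sym (only-x y y∈)) (x∈⁅x⁆ x))
                      (λ y∈ → subst (_∈ₛ p) (sym (x∈⁅y⁆⇒x≡y x y∈)) x∈)

  module ConnectedComponents (E : Fin n → Fin n → Set) (E? : ∀ x y → Dec (E x y))
                             (E-sym : ∀ {x y} → E x y → E y x) where

    Closed : Subset n → Set
    Closed U = ∀ {z y} → z ∈ₛ U → E z y → y ∈ₛ U

    ComponentOf : Fin n → Subset n → Set
    ComponentOf x U =
      ∃ λ C → x ∈ₛ C × C ⊆ U × (∀ {y} → y ∈ₛ C → Star E x y) × Closed C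

    -- add one E-neighbour of S at a time; fuel + ∣ S ∣ ≥ n guarantees that
    -- S stops growing before the fuel runs out
    saturate : ∀ fuel U → Closed U → ∀ x S → x ∈ₛ S → S ⊆ U → (∀ {y} → y ∈ₛ S → Star E x y)
             → n ≤ ∣ S ∣ + fuel → ComponentOf x U
    saturate fuel U U-closed x S x∈S S⊆U reach bound
      with any? (λ y → ¬? (y ∈? S) ×-dec any? (λ z → (z ∈? S) ×-dec E? z y))
    ... | no no-exit = S , x∈S , S⊆U , reach , S-closed
      where
      S-closed : Closed S
      S-closed {z} {y} z∈S zy with y ∈? S
      ... | yes y∈S = y∈S
      ... | no y∉S  = ⊥-elim (no-exit (y , y∉S , z , z∈S , zy))
    saturate zero U _ x S _ _ _ bound | yes (y , y∉S , _) =
      ⊥-elim (y∉S (subst (y ∈ₛ_) (sym S≡⊤) ∈⊤))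
      where
      S≡⊤ : S ≡ ⊤
      S≡⊤ = ∣p∣≡n⇒p≡⊤ (≤-antisym (∣p∣≤n S) (subst (n ≤_) (+-identityʳ _) bound))
    saturate (suc fuel) U U-closed x S x∈S S⊆U reach bound | yes (y , y∉S , z , z∈S , zy) =
      saturate fuel U U-closed x (S ∪ ⁅ y ⁆) (x∈p∪q⁺ (inj₁ x∈S)) S′⊆U reach′ bound′
      where
      S′⊆U : S ∪ ⁅ y ⁆ ⊆ U
      S′⊆U w∈ with x∈p∪q⁻ S ⁅ y ⁆ w∈
      ... | inj₁ w∈S = S⊆U w∈S
      ... | inj₂ w∈y rewrite x∈⁅y⁆⇒x≡y y w∈y = U-closed (S⊆U z∈S) zy
      reach′ : ∀ {w} → w ∈ₛ S ∪ ⁅ y ⁆ → Star E x w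
      reach′ w∈ with x∈p∪q⁻ S ⁅ y ⁆ w∈
      ... | inj₁ w∈S = reach w∈S
      ... | inj₂ w∈y rewrite x∈⁅y⁆⇒x≡y y w∈y = reach z∈S ◅◅ zy ◅ ε
      grows : ∣ S ∣ < ∣ S ∪ ⁅ y ⁆ ∣
      grows = p⊂q⇒∣p∣<∣q∣ (x∈p∪q⁺ ∘ inj₁ , y , x∈p∪q⁺ (inj₂ (x∈⁅x⁆ y)) , y∉S)
      bound′ : n ≤ ∣ S ∪ ⁅ y ⁆ ∣ + fuel
      bound′ = ≤-trans bound
        (subst (_≤ ∣ S ∪ ⁅ y ⁆ ∣ + fuel) (sym (+-suc ∣ S ∣ fuel)) (+-monoˡ-≤ fuel grows))

    componentOf : ∀ U → Closed U → ∀ {x} → x ∈ₛ U → ComponentOf x U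
    componentOf U U-closed {x} x∈U =
      saturate n U U-closed x ⁅ x ⁆ (x∈⁅x⁆ x) (λ y∈ → subst (_∈ₛ U) (sym (x∈⁅y⁆⇒x≡y x y∈)) x∈U)
               (λ y∈ → subst (Star E x) (sym (x∈⁅y⁆⇒x≡y x y∈)) ε) (m≤n+m n _)

    IsComponentList : Subset n → List (Subset n) → Set
    IsComponentList U Cs =
      All Nonempty Cs × ⋃ Cs ≡ U
      × AllPairs (λ C D → Empty (C ∩ D) × (∀ x y → x ∈ₛ C → y ∈ₛ D → ¬ E x y)) Cs
      × All (λ C → ∀ x y → x ∈ₛ C → y ∈ₛ C → Star E x y) Cs

    components : ∀ fuel U → ∣ U ∣ ≤ fuel → Closed U → ∃ (IsComponentList U)
    components fuel U _ _ with nonempty? U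
    components fuel U _ _ | no U-empty = [] , [] , sym (Empty-unique U-empty) , [] , []
    components zero U bound _ | yes (x , x∈U) with () ← ≤-trans (x∈p⇒1≤∣p∣ x∈U) bound
    components (suc fuel) U bound U-closed | yes (x , x∈U) with componentOf U U-closed x∈U
    ... | C , x∈C , C⊆U , reach , C-closed with components fuel (U ─ C) bound′ rest-closed
      where
      bound′ : ∣ U ─ C ∣ ≤ fuel
      bound′ = ≤-pred (≤-trans (p∩q≢∅⇒∣p─q∣<∣p∣ U C (x , x∈p∩q⁺ (x∈U , x∈C))) bound)
      rest-closed : Closed (U ─ C)
      rest-closed {z} z∈ zy = x∈p∧x∉q⇒x∈p─q (U-closed (p─q⊆p U C z∈) zy)
                                            (λ y∈C → x∈p─q⇒x∉q U C z∈ (C-closed y∈C (E-sym zy)))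
    ... | Cs , nonempty , ⋃Cs≡U─C , separated , connected =
      C ∷ Cs , (x , x∈C) ∷ nonempty , ⋃≡U , C-separated ∷ separated , C-connected ∷ connected
      where
      ∉C : ∀ {D y} → D ∈ Cs → y ∈ₛ D → y ∉ₛ C
      ∉C D∈ y∈D = x∈p─q⇒x∉q U C (subst (_ ∈ₛ_) ⋃Cs≡U─C (∈-⋃⁺ D∈ y∈D))
      ⋃≡U : C ∪ ⋃ Cs ≡ U
      ⋃≡U = ⊆-antisym ⊆U U⊆
        where
        ⊆U : C ∪ ⋃ Cs ⊆ U
        ⊆U y∈ with x∈p∪q⁻ C (⋃ Cs) y∈
        ... | inj₁ y∈C  = C⊆U y∈C
        ... | inj₂ y∈Cs = p─q⊆p U C (subst (_ ∈ₛ_) ⋃Cs≡U─C y∈Cs)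
        U⊆ : U ⊆ C ∪ ⋃ Cs
        U⊆ {y} y∈U with y ∈? C
        ... | yes y∈C = x∈p∪q⁺ (inj₁ y∈C)
        ... | no y∉C  = x∈p∪q⁺ (inj₂ (subst (y ∈ₛ_) (sym ⋃Cs≡U─C) (x∈p∧x∉q⇒x∈p─q y∈U y∉C)))
      C-separated : All (λ D → Empty (C ∩ D) × (∀ x y → x ∈ₛ C → y ∈ₛ D → ¬ E x y)) Cs
      C-separated = All.tabulate λ D∈ →
        (λ (y , y∈C∩D) → ∉C D∈ (proj₂ (x∈p∩q⁻ C _ y∈C∩D)) (proj₁ (x∈p∩q⁻ C _ y∈C∩D)))
        , λ y w y∈C w∈D yw → ∉C D∈ w∈D (C-closed y∈C yw)
      C-connected : ∀ y w → y ∈ₛ C → w ∈ₛ C → Star E y w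
      C-connected y w y∈C w∈C = reverse E-sym (reach y∈C) ◅◅ reach w∈C

  distinct-∈⇒2≤length : ∀ {C D : Subset n} {Cs} → C ∈ Cs → D ∈ Cs → C ≢ D → 2 ≤ length Cs
  distinct-∈⇒2≤length (here refl) (here refl) C≢D = ⊥-elim (C≢D refl)
  distinct-∈⇒2≤length (here _) (there (here _)) _ = s≤s (s≤s z≤n)
  distinct-∈⇒2≤length (here _) (there (there _)) _ = s≤s (s≤s z≤n)
  distinct-∈⇒2≤length (there (here _)) (here _) _ = s≤s (s≤s z≤n)
  distinct-∈⇒2≤length (there (there _)) (here _) _ = s≤s (s≤s z≤n)
  distinct-∈⇒2≤length (there C∈) (there D∈) C≢D = ≤-trans (distinct-∈⇒2≤length C∈ D∈ C≢D) (n≤1+n _)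

  AllPairs-∈ : ∀ {Q : Subset n → Subset n → Set} {C D Cs} → AllPairs Q Cs
             → C ∈ Cs → D ∈ Cs → C ≡ D ⊎ Q C D ⊎ Q D C
  AllPairs-∈ _         (here refl) (here refl) = inj₁ refl
  AllPairs-∈ (Q-C ∷ _) (here refl) (there D∈)  = inj₂ (inj₁ (All.lookup Q-C D∈))
  AllPairs-∈ (Q-D ∷ _) (there C∈)  (here refl) = inj₂ (inj₂ (All.lookup Q-D C∈))
  AllPairs-∈ (_ ∷ Qs)  (there C∈)  (there D∈)  = AllPairs-∈ Qs C∈ D∈

  restrict? : ∀ {R : Triples {n}} L′ → (∀ a b c → Dec (R a b c)) → ∀ a b c → Dec (restrict R L′ a b c)
  restrict? L′ R? a b c = R? a b c ×-dec (a ∈? L′) ×-dec (b ∈? L′) ×-dec (c ∈? L′)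

  ahoEdge? : ∀ {R : Triples {n}} L′ → (∀ a b c → Dec (R a b c)) → ∀ x y → Dec (AhoEdge R L′ x y)
  ahoEdge? L′ R? x y = (x ∈? L′) ×-dec (y ∈? L′) ×-dec any? (λ z → R? x y z ⊎-dec R? y x z)

  ahoEdge-sym : ∀ {R : Triples {n}} {L′ x y} → AhoEdge R L′ x y → AhoEdge R L′ y x
  ahoEdge-sym (x∈ , y∈ , z , inj₁ r) = y∈ , x∈ , z , inj₂ r
  ahoEdge-sym (x∈ , y∈ , z , inj₂ r) = y∈ , x∈ , z , inj₁ r

  module _ (T : Tree n) (PT : PhyloOn T) where

    private
      U : Unique (leaves T)
      U = proj₁ (proj₂ PT)
      T∋ : ∀ x → x ∈ leaves T
      T∋ = proj₂ (proj₂ PT)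
      A : Fin n → Vertex
      A = addr T

    lcpOf : Vertex → List (Fin n) → Vertex
    lcpOf p []       = p
    lcpOf p (z ∷ zs) = lcpOf (lcp p (A z)) zs

    lcpOf-⪰ : ∀ p zs → p ⪯ lcpOf p zs
    lcpOf-⪰ p []       = ⪯-refl p
    lcpOf-⪰ p (z ∷ zs) = ⪯-trans (lcp-⪯ˡ p (A z)) (lcpOf-⪰ _ zs)

    lcpOf-upper : ∀ p {z zs} → z ∈ zs → A z ⪯ lcpOf p zs
    lcpOf-upper p {zs = z ∷ zs} (here refl) = ⪯-trans (lcp-⪯ʳ p (A z)) (lcpOf-⪰ _ zs)
    lcpOf-upper p {zs = w ∷ _}  (there z∈)  = lcpOf-upper (lcp p (A w)) z∈

    lcpOf-cases : ∀ {a} p zs → a ⪯ p → lcpOf p zs ≡ p ⊎ ∃ λ z → z ∈ zs × lcpOf p zs ≡ lcp a (A z)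
    lcpOf-cases p [] _ = inj₁ refl
    lcpOf-cases {a} p (z ∷ zs) a⪯p with lcpOf-cases (lcp p (A z)) zs (⪯-trans a⪯p (lcp-⪯ˡ p (A z)))
    ... | inj₂ (w , w∈ , e) = inj₂ (w , there w∈ , e)
    ... | inj₁ e with lcp-descendant p (A z) a⪯p
    ...   | inj₁ e′ = inj₁ (trans e e′)
    ...   | inj₂ e′ = inj₂ (z , here refl , trans e e′)

    -- With P the lca of L′, the leaves w with lca(x,w) ≠ P are closed under
    -- Aho edges (an edge ww′ comes from a triple, so lca(w,w′) ≺ P), and they
    -- contain x but not the leaf z with lca(x,z) = P.
    aho-disconnected : (R : Triples {n}) → (∀ a b c → R a b c → Displays T a b c)
      → ∀ L′ {x y} → x ∈ₛ L′ → y ∈ₛ L′ → x ≢ y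
      → ∃ λ z → z ∈ₛ L′ × ¬ Star (AhoEdge (restrict R L′) L′) x z
    aho-disconnected R displays L′ {x} {y} x∈ y∈ x≢y =
      separate (lcpOf-cases (A x) L′-list (⪯-refl (A x)))
      where
      L′-list : List (Fin n)
      L′-list = filter (_∈? L′) (allFin n)
      P : Vertex
      P = lcpOf (A x) L′-list
      below : ∀ {w} → w ∈ₛ L′ → A w ⪯ P
      below {w} w∈ = lcpOf-upper (A x) (∈-filter⁺ (_∈? L′) {xs = allFin n} (∈-allFin w) w∈)
      Ax≢P : A x ≢ P
      Ax≢P e = x≢y (sym (addr-⪯⇒≡ {T = T} U (T∋ x) (T∋ y) (subst (A y ⪯_) (sym e) (below y∈))))
      triple-below : ∀ {a b c} → restrict R L′ a b c → lcp (A a) (A b) ≢ P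
      triple-below {a} {b} {c} (r , a∈ , _ , c∈) ab≡P =
        ≺⇒⋡ (proj₁ (proj₂ (proj₂ (proj₂ (displays a b c r)))))
             (subst (lcp (A a) (A c) ⪯_) (sym ab≡P) (lcp-greatest P (below a∈) (below c∈)))
      Away : Fin n → Set
      Away w = lcp (A x) (A w) ≢ P
      edge-away : ∀ {w w′} → AhoEdge (restrict R L′) L′ w w′ → Away w → Away w′
      edge-away {w} {w′} (w∈ , _ , _ , t) away xw′≡P = contradiction t
        where
        xw≺xw′ : lcp (A x) (A w) ≺ lcp (A x) (A w′)
        xw≺xw′ = subst (lcp (A x) (A w) ⪯_) (sym xw′≡P) (lcp-greatest P (below x∈) (below w∈))
               , λ e → away (trans e xw′≡P)
        ww′≡P : lcp (A w) (A w′) ≡ P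
        ww′≡P = trans (sym (lcp-ultrametric (A x) (A w) (A w′) xw≺xw′)) xw′≡P
        contradiction : ∀ {v} → restrict R L′ w w′ v ⊎ restrict R L′ w′ w v → ⊥
        contradiction (inj₁ r) = triple-below r ww′≡P
        contradiction (inj₂ r) = triple-below r (trans (lcp-comm (A w′) (A w)) ww′≡P)
      path-away : ∀ {w w′} → Star (AhoEdge (restrict R L′) L′) w w′ → Away w → Away w′
      path-away ε         away = away
      path-away (e ◅ es) away = path-away es (edge-away e away)
      separate : P ≡ A x ⊎ ∃ (λ z → z ∈ L′-list × P ≡ lcp (A x) (A z))
               → ∃ λ z → z ∈ₛ L′ × ¬ Star (AhoEdge (restrict R L′) L′) x z
      separate (inj₁ P≡Ax) = ⊥-elim (Ax≢P (sym P≡Ax))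
      separate (inj₂ (z , z∈ , P≡xz)) =
        z , proj₂ (∈-filter⁻ (_∈? L′) {xs = allFin n} z∈)
          , λ path → path-away path (λ e → Ax≢P (trans (sym (lcp-idem (A x))) e)) (sym P≡xz)

    aho-split : (R : Triples {n}) → (∀ a b c → Dec (R a b c)) → (∀ a b c → R a b c → Displays T a b c)
      → ∀ L′ {x y} → x ∈ₛ L′ → y ∈ₛ L′ → x ≢ y
      → ∃ λ Cs → Components (restrict R L′) L′ Cs × 2 ≤ length Cs
                 × All (λ C → Nonempty C × ∣ C ∣ < ∣ L′ ∣) Cs
    aho-split R R? displays L′ {x} x∈ y∈ x≢y
      with aho-disconnected R displays L′ x∈ y∈ x≢y
         | ConnectedComponents.components (AhoEdge (restrict R L′) L′) (ahoEdge? L′ (restrict? L′ R?))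
             (ahoEdge-sym {R = restrict R L′}) ∣ L′ ∣ L′ ≤-refl (λ _ e → proj₁ (proj₂ e))
    ... | z , z∈ , x↛z | Cs , comps@(nonempty , ⋃Cs≡L′ , _ , connected)
      with ∈-⋃⁻ Cs (subst (x ∈ₛ_) (sym ⋃Cs≡L′) x∈) | ∈-⋃⁻ Cs (subst (z ∈ₛ_) (sym ⋃Cs≡L′) z∈)
    ...   | Cx , Cx∈ , x∈Cx | Cz , Cz∈ , z∈Cz =
      Cs , comps , distinct-∈⇒2≤length Cx∈ Cz∈ Cx≢Cz
      , All.tabulate λ C∈ → All.lookup nonempty C∈ , smaller C∈
      where
      x∈C⇒z∉C : ∀ {C} → C ∈ Cs → x ∈ₛ C → z ∉ₛ C
      x∈C⇒z∉C C∈ x∈C z∈C = x↛z (All.lookup connected C∈ x z x∈C z∈C)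
      Cx≢Cz : Cx ≢ Cz
      Cx≢Cz refl = x∈C⇒z∉C Cx∈ x∈Cx z∈Cz
      smaller : ∀ {C} → C ∈ Cs → ∣ C ∣ < ∣ L′ ∣
      smaller {C} C∈ = p⊂q⇒∣p∣<∣q∣ (C⊆L′ , outside-C (x ∈? C))
        where
        C⊆L′ : C ⊆ L′
        C⊆L′ {w} w∈C = subst (w ∈ₛ_) ⋃Cs≡L′ (∈-⋃⁺ C∈ w∈C)
        outside-C : Dec (x ∈ₛ C) → ∃ λ w → w ∈ₛ L′ × w ∉ₛ C
        outside-C (yes x∈C) = z , z∈ , x∈C⇒z∉C C∈ x∈C
        outside-C (no x∉C)  = x , x∈ , x∉C

    build : ∀ fuel (R : Triples {n}) L′ → ∣ L′ ∣ ≤ fuel → Nonempty L′ → (∀ a b c → Dec (R a b c))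
          → (∀ a b c → R a b c → Displays T a b c) → ∃ (IsBuild R L′)
    buildAll : ∀ fuel (R : Triples {n}) Cs → All (λ C → Nonempty C × ∣ C ∣ ≤ fuel) Cs
             → (∀ a b c → Dec (R a b c)) → (∀ a b c → R a b c → Displays T a b c)
             → ∃ λ Ts → Pointwise (λ C S → IsBuild (restrict R C) C S) Cs Ts
    build zero R L′ bound (x , x∈) _ _ with () ← ≤-trans (x∈p⇒1≤∣p∣ x∈) bound
    build (suc fuel) R L′ bound (x , x∈) R? displays
      with any? (λ y → (y ∈? L′) ×-dec ¬? (y ≟ᶠ x))
    ... | no only-x = leaf x , single (singleton⇒∣p∣≡1 x∈ ≡x) x∈
      where
      ≡x : ∀ y → y ∈ₛ L′ → y ≡ x
      ≡x y y∈ with y ≟ᶠ x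
      ... | yes y≡x = y≡x
      ... | no y≢x  = ⊥-elim (only-x (y , y∈ , y≢x))
    ... | yes (y , y∈ , y≢x) with aho-split R R? displays L′ x∈ y∈ (y≢x ∘ sym)
    ...   | Cs , comps , two , small with buildAll fuel R Cs (All.map shrink small) R? displays
      where
      shrink : ∀ {C} → Nonempty C × ∣ C ∣ < ∣ L′ ∣ → Nonempty C × ∣ C ∣ ≤ fuel
      shrink (ne , <L′) = ne , ≤-pred (<-≤-trans <L′ bound)
    ...     | Ts , subtrees = node Ts , split comps two subtrees
    buildAll fuel R []       []                    _  _        = [] , []
    buildAll fuel R (C ∷ Cs) ((ne , bound) ∷ rest) R? displays
      with build fuel (restrict R C) C bound ne (restrict? C R?) (λ a b c r → displays a b c (proj₁ r))
         | buildAll fuel R Cs rest R? displays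
    ... | S , isBuild | Ss , isBuilds = S ∷ Ss , isBuild ∷ isBuilds

  aho-edge-within-component : ∀ {R : Triples {n}} {L′ Cs a b} → Components R L′ Cs → AhoEdge R L′ a b
                            → ∃ λ C → C ∈ Cs × a ∈ₛ C × b ∈ₛ C
  aho-edge-within-component {R} {Cs = Cs} {a} {b} (_ , ⋃Cs≡L′ , separated , _) ab@(a∈ , b∈ , _)
    with ∈-⋃⁻ Cs (subst (a ∈ₛ_) (sym ⋃Cs≡L′) a∈) | ∈-⋃⁻ Cs (subst (b ∈ₛ_) (sym ⋃Cs≡L′) b∈)
  ... | C , C∈ , a∈C | D , D∈ , b∈D with AllPairs-∈ separated C∈ D∈
  ...   | inj₁ refl              = C , C∈ , a∈C , b∈D
  ...   | inj₂ (inj₁ (_ , no-CD)) = ⊥-elim (no-CD a b a∈C b∈D ab)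
  ...   | inj₂ (inj₂ (_ , no-DC)) = ⊥-elim (no-DC b a b∈D a∈C (ahoEdge-sym {R = R} ab))

  pointwise-∈ʳ : ∀ {ℓ} {Rel : Subset n → Tree n → Set ℓ} {Cs Ts S} → Pointwise Rel Cs Ts → S ∈ Ts
               → ∃ λ C → C ∈ Cs × Rel C S
  pointwise-∈ʳ (r ∷ _)  (here refl) = _ , here refl , r
  pointwise-∈ʳ (_ ∷ rs) (there S∈) with pointwise-∈ʳ rs S∈
  ... | C , C∈ , r = C , there C∈ , r

  pointwise-∈ˡ : ∀ {ℓ} {Rel : Subset n → Tree n → Set ℓ} {Cs Ts C} → Pointwise Rel Cs Ts → C ∈ Cs
               → ∃ λ i → ∃ λ S → Nth Ts i S × Rel C S
  pointwise-∈ˡ (r ∷ _)  (here refl) = 0 , _ , zero , r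
  pointwise-∈ˡ (_ ∷ rs) (there C∈) with pointwise-∈ˡ rs C∈
  ... | i , S , i-th , r = suc i , S , suc i-th , r

  HasLeafSet : Tree n → Subset n → Set
  HasLeafSet S L′ = ∀ x → x ∈ leaves S ⇔ x ∈ₛ L′

  ClusterDisplaysAll : Triples {n} → Subset n → Tree n → Set
  ClusterDisplaysAll R L′ S = ∀ a b c → R a b c → a ∈ₛ L′ → b ∈ₛ L′ → c ∈ₛ L′ → ClusterDisplays S a b c

  node-leafSet : ∀ {ℓ} {Rel : Subset n → Tree n → Set ℓ} {Cs Ts L′} → ⋃ Cs ≡ L′
    → (∀ {C S} → Rel C S → HasLeafSet S C) → Pointwise Rel Cs Ts → HasLeafSet (node Ts) L′
  node-leafSet {Cs = Cs} {Ts} {L′} ⋃Cs≡L′ leafSet rels x = mk⇔ ⊆L′ L′⊆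
    where
    ⊆L′ : x ∈ leavesList Ts → x ∈ₛ L′
    ⊆L′ x∈ with ∈-leavesList⁻ Ts x∈
    ... | S , S∈ , x∈S with pointwise-∈ʳ rels S∈
    ...   | C , C∈ , rel = subst (x ∈ₛ_) ⋃Cs≡L′ (∈-⋃⁺ C∈ (Equivalence.to (leafSet rel x) x∈S))
    L′⊆ : x ∈ₛ L′ → x ∈ leavesList Ts
    L′⊆ x∈ with ∈-⋃⁻ Cs (subst (x ∈ₛ_) (sym ⋃Cs≡L′) x∈)
    ... | C , C∈ , x∈C with pointwise-∈ˡ rels C∈
    ...   | _ , S , i-th , rel = ∈-leavesList⁺ (Nth⇒∈ i-th) (Equivalence.from (leafSet rel x) x∈C)

  -- a and b lie in one component C; the cluster is found inside its subtree, or is that subtree if c ∉ C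
  node-clusterDisplaysAll : ∀ {R : Triples {n}} {L′ Cs Ts} → Components (restrict R L′) L′ Cs
    → Pointwise (λ C S → HasLeafSet S C × ClusterDisplaysAll (restrict R C) C S) Cs Ts
    → ClusterDisplaysAll R L′ (node Ts)
  node-clusterDisplaysAll comps sound a b c r a∈ b∈ c∈
    with aho-edge-within-component comps (a∈ , b∈ , c , inj₁ (r , a∈ , b∈ , c∈))
  ... | C , C∈ , a∈C , b∈C with pointwise-∈ˡ sound C∈ | c ∈? C
  ...   | i , S , i-th , (_ , clusters-S) | yes c∈C
    with clusters-S a b c (r , a∈C , b∈C , c∈C) a∈C b∈C c∈C
  ...     | p , S′ , at , cluster = i ∷ p , S′ , child i-th at , cluster
  node-clusterDisplaysAll comps sound a b c r a∈ b∈ c∈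
      | C , C∈ , a∈C , b∈C | i , S , i-th , (leaves-S , _) | no c∉C =
    i ∷ [] , S , child i-th root , from (leaves-S a) a∈C , from (leaves-S b) b∈C , c∉C ∘ to (leaves-S c)
    where open Equivalence

  IsBuild-sound : ∀ {R : Triples {n}} {L′ S} → (∀ a b c → R a b c → a ≢ c) → IsBuild R L′ S
                → HasLeafSet S L′ × ClusterDisplaysAll R L′ S
  IsBuild-sound* : ∀ {R : Triples {n}} {Cs Ts} → (∀ a b c → R a b c → a ≢ c)
    → Pointwise (λ C S → IsBuild (restrict R C) C S) Cs Ts
    → Pointwise (λ C S → HasLeafSet S C × ClusterDisplaysAll (restrict R C) C S) Cs Ts
  IsBuild-sound distinct (single {x = x} ∣L′∣≡1 x∈) =
    (λ y → mk⇔ (λ { (here refl) → x∈ }) λ y∈ → here (∣p∣≡1⇒x≡y ∣L′∣≡1 y∈ x∈))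
    , λ a b c r a∈ _ c∈ → ⊥-elim (distinct a b c r (∣p∣≡1⇒x≡y ∣L′∣≡1 a∈ c∈))
  IsBuild-sound distinct (split {R} {Cs = Cs} {Ts} comps@(_ , ⋃Cs≡L′ , _) _ subtrees) =
    node-leafSet ⋃Cs≡L′ proj₁ sound , node-clusterDisplaysAll comps sound
    where
    sound : Pointwise (λ C S → HasLeafSet S C × ClusterDisplaysAll (restrict R C) C S) Cs Ts
    sound = IsBuild-sound* distinct subtrees
  IsBuild-sound* distinct []                 = []
  IsBuild-sound* distinct (build ∷ builds) =
    IsBuild-sound (λ a b c r → distinct a b c (proj₁ r)) build ∷ IsBuild-sound* distinct builds

module _ {n k : ℕ} (G : Digraph {n}) (σ : Fin n → Fin k) where

  binaryExplainable⇒consistent : BinaryExplainableQBMG G σ → Consistent (ℛᴮ G σ)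
  binaryExplainable⇒consistent (T , u , BT , E) =
    T , proj₁ E , binaryExplainer-displays-ℛᴮ G σ T u E BT

  consistent⇒binaryExplainable : ProperlyColored G σ → Consistent (ℛᴮ G σ) → BinaryExplainableQBMG G σ
  consistent⇒binaryExplainable proper (T , PT@(_ , U , T∋) , displays) =
    binarize T , truncation G σ proper (binarize T) PT′ displays′ , binarize-binary (proj₁ PT)
    , displaying-tree-explains G σ proper (binarize T) PT′ displays′
    where
    PT′ : PhyloOn (binarize T)
    PT′ = binarize-phyloOn PT
    displays′ : ∀ a b c → ℛᴮ G σ a b c → Displays (binarize T) a b c
    displays′ = refinement-displays PT′ (binarize-refines T) (λ _ _ _ → ℛᴮ-distinct G σ)
      λ a b c r → displays⇒clusterDisplays U (T∋ a) (T∋ b) (displays a b c r)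

  consistent⇒build : Consistent (ℛᴮ G σ) → ∃ (IsBuild (ℛᴮ G σ) ⊤)
  consistent⇒build (T , PT , displays) =
    build T PT n (ℛᴮ G σ) ⊤ (∣p∣≤n ⊤) (proj₁ (Phylo⇒leaf (proj₁ PT)) , ∈⊤) (ℛᴮ? G σ) displays

  build-refinement-explains : ProperlyColored G σ → ∀ T₀ → IsBuild (ℛᴮ G σ) ⊤ T₀
    → ∀ T → PhyloOn T → Refines T T₀ → Σ (Fin n → Fin k → Vertex) λ u → Explains T σ u G
  build-refinement-explains proper T₀ isBuild T PT T≤T₀ =
    truncation G σ proper T PT displays , displaying-tree-explains G σ proper T PT displays
    where
    clusters : ClusterDisplaysAll (ℛᴮ G σ) ⊤ T₀
    clusters = proj₂ (IsBuild-sound (λ _ _ _ r → proj₁ (proj₂ (ℛᴮ-distinct G σ r))) isBuild)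
    displays : ∀ a b c → ℛᴮ G σ a b c → Displays T a b c
    displays = refinement-displays PT T≤T₀ (λ _ _ _ → ℛᴮ-distinct G σ)
      λ a b c r → clusters a b c r ∈⊤ ∈⊤ ∈⊤

theorem4 : ∀ {n k : ℕ} (G : Digraph {n}) (σ : Fin n → Fin k)
    → ProperlyColored G σ
    → (BinaryExplainableQBMG G σ ⇔ Consistent (ℛᴮ G σ))
      × (Consistent (ℛᴮ G σ)
         → (Σ (Tree n) λ T₀ → IsBuild (ℛᴮ G σ) ⊤ T₀)
           × (∀ T₀ → IsBuild (ℛᴮ G σ) ⊤ T₀
              → ∀ T → PhyloOn T → Refines T T₀
              → Σ (Fin n → Fin k → Vertex) λ u → Explains T σ u G))
theorem4 G σ proper =
  mk⇔ (binaryExplainable⇒consistent G σ) (consistent⇒binaryExplainable G σ proper)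
  , λ consistent → consistent⇒build G σ consistent , build-refinement-explains G σ proper
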